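{- Let $\Delta$ be a finite simple graph on $n$ vertices, $G\le\mathrm{Aut}(\Delta)$, and $H$ a permutation group of degree $m$. Let $\Gamma$ be the disjoint union of $m$ copies of $\Delta$, with $G\wr H$ acting on it (the base group $G^m$ acting on the copies coordinatewise and $H$ permuting the copies). Then \[P_{\Gamma,G\wr H}(x)=|G|^mF_H\bigl(P_{\Delta,G}(x)/|G|\bigr).\] In particular, if $(\Delta,G)$ is a reciprocal pair and $H$ contains no odd permutations, then $(\Gamma,G\wr H)$ is a reciprocal pair.
   Context: $F_K(x)=\sum_{g\in K}x^{c(g)}$ for a permutation group $K$, $c(g)$ the number of cycles of $g$. For $g\in\mathrm{Aut}(\Gamma)$, $\Gamma/g$ has the cycles of $g$ as vertices, two (possibly equal, giving a loop) joined if an edge of $\Gamma$ joins vertices in them; $P_{\Gamma/g}$ is its chromatic polynomial ($0$ if there is a loop). $P_{\Gamma,G}(x)=\sum_{g\in G}P_{\Gamma/g}(x)$. $(\Gamma,G)$ is a reciprocal pair if $P_{\Gamma,G}(x)=(-1)^NF_G(-x)$, $N$ the number of vertices of $\Gamma$ and $F_G$ computed on vertices. -}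

module Defs where

open import Data.Nat as ℕ using (ℕ; zero; suc)
open import Data.Nat.Divisibility using (_∣_)
open import Data.Bool using (Bool; true; false; _∧_)
open import Data.Fin as Fin using (Fin; zero; suc; toℕ; remQuot; combine; _<_)
open import Data.Fin.Properties using (all?; _≟_)
open import Data.Integer using (+_)
open import Data.Rational as ℚ using (ℚ; 0ℚ; 1ℚ; _/_; _+_; _*_; -_)
open import Data.List as List using (List; []; _∷_; length; filter; map; concatMap; allFin)
open import Data.List.Relation.Unary.All using (All)
open import Data.List.Relation.Unary.Any using (Any)
open import Data.List.Relation.Unary.AllPairs using (AllPairs)
open import Data.Vec as Vec using (Vec; lookup)
open import Data.Product using (_×_; _,_)
open import Function using (_∘_; id)
open import Function.Definitions using (Bijective)
open import Relation.Binary.PropositionalEquality using (_≡_; _≢_; refl)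
open import Relation.Nullary using (Dec; ¬_; ¬?; _→-dec_)
open import Data.Bool.Properties using () renaming (_≟_ to _≟ᵇ_)
open import Data.Nat.Properties using () renaming (_≟_ to _≟ℕ_)

Adj : ℕ → Set
Adj N = Fin N → Fin N → Bool

record SimpleGraph (n : ℕ) : Set where
  field
    adj   : Adj n
    sym   : ∀ u v → adj u v ≡ adj v u
    irrefl : ∀ u → adj u u ≡ false

Map : ℕ → Set
Map n = Fin n → Fin n

_≗_ : ∀ {n} → Map n → Map n → Set
σ ≗ τ = ∀ i → σ i ≡ τ i

_∈ₑ_ : ∀ {n} → Map n → List (Map n) → Set
σ ∈ₑ xs = Any (λ τ → τ ≗ σ) xs

-- A permutation group of degree n, given by the duplicate-free list of
-- its elements: bijections of Fin n, containing the identity and closed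
-- under composition (hence a subgroup of Sym(n), Fin n being finite).
record PermGroup (n : ℕ) : Set where
  field
    elems    : List (Map n)
    bij      : All (Bijective _≡_ _≡_) elems
    distinct : AllPairs (λ σ τ → ¬ (σ ≗ τ)) elems
    hasId    : id ∈ₑ elems
    closed   : ∀ σ τ → σ ∈ₑ elems → τ ∈ₑ elems → (σ ∘ τ) ∈ₑ elems
open PermGroup public

order : ∀ {n} → PermGroup n → ℕ
order K = length (elems K)

_≤Aut_ : ∀ {n} → PermGroup n → SimpleGraph n → Set
K ≤Aut Δ = All (λ σ → ∀ u v → SimpleGraph.adj Δ (σ u) (σ v) ≡ SimpleGraph.adj Δ u v) (elems K)

iter : ∀ {n} → Map n → ℕ → Map n
iter σ zero    = id
iter σ (suc k) = σ ∘ iter σ k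

IsCycleMin : ∀ {N} → Map N → Fin N → Set
IsCycleMin {N} σ i = ∀ (k : Fin N) → toℕ i ℕ.≤ toℕ (iter σ (toℕ k) i)

isCycleMin? : ∀ {N} (σ : Map N) (i : Fin N) → Dec (IsCycleMin σ i)
isCycleMin? σ i = all? (λ k → toℕ i ℕ.≤? toℕ (iter σ (toℕ k) i))

cycles : ∀ {N} → Map N → ℕ
cycles {N} σ = length (filter (isCycleMin? σ) (allFin N))

Inversion : ∀ {N} → Map N → Fin N × Fin N → Set
Inversion σ (i , j) = (i < j) × (σ j < σ i)

inversion? : ∀ {N} (σ : Map N) (p : Fin N × Fin N) → Dec (Inversion σ p)
inversion? σ (i , j) = (i Fin.<? j) Relation.Nullary.×-dec (σ j Fin.<? σ i)
  where import Relation.Nullary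

allPairs : (N : ℕ) → List (Fin N × Fin N)
allPairs N = concatMap (λ i → map (λ j → (i , j)) (allFin N)) (allFin N)

inversions : ∀ {N} → Map N → ℕ
inversions {N} σ = length (filter (inversion? σ) (allPairs N))

EvenPerm : ∀ {N} → Map N → Set
EvenPerm σ = 2 ∣ inversions σ

allVecs : (x N : ℕ) → List (Vec (Fin x) N)
allVecs x zero    = Vec.[] ∷ []
allVecs x (suc N) = concatMap (λ c → map (c Vec.∷_) (allVecs x N)) (allFin x)

-- A colouring of Γ/g with x colours is a colouring of the cycles of g,
-- i.e. a colouring f of the vertices of Γ constant on each cycle of g
-- (f ∘ g = f); it is proper iff vertices of Γ joined by an edge get
-- different colours (a loop of Γ/g makes this impossible).
ProperQuotColouring : ∀ {N x} → Adj N → Map N → Vec (Fin x) N → Set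
ProperQuotColouring adj g f =
  (∀ v → lookup f (g v) ≡ lookup f v) ×
  (∀ u v → adj u v ≡ true → lookup f u ≢ lookup f v)

properQuot? : ∀ {N x} (adj : Adj N) (g : Map N) (f : Vec (Fin x) N) →
              Dec (ProperQuotColouring adj g f)
properQuot? adj g f =
  all? (λ v → lookup f (g v) ≟ lookup f v) Relation.Nullary.×-dec
  all? (λ u → all? (λ v → (adj u v ≟ᵇ true) →-dec ¬? (lookup f u ≟ lookup f v)))
  where import Relation.Nullary

chromQuot : ∀ {N} → Adj N → Map N → ℕ → ℕ
chromQuot {N} adj g x = length (filter (properQuot? adj g) (allVecs x N))

_^_ : ℚ → ℕ → ℚ
q ^ zero  = 1ℚ
q ^ suc k = q * (q ^ k)

sumℚ : List ℚ → ℚ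
sumℚ = List.foldr _+_ 0ℚ

sumℕ : List ℕ → ℕ
sumℕ = List.foldr ℕ._+_ 0

fromℕ : ℕ → ℚ
fromℕ k = + k / 1

F : ∀ {N} → List (Map N) → ℚ → ℚ
F K y = sumℚ (map (λ g → y ^ cycles g) K)

P : ∀ {N} → Adj N → List (Map N) → ℕ → ℕ
P adj K x = sumℕ (map (λ g → chromQuot adj g x) K)

-- (Γ,K) is a reciprocal pair: P_{Γ,K}(x) = (-1)^N F_K(-x) as polynomials,
-- i.e. (both sides being polynomials) at every x ∈ ℕ.
Reciprocal : ∀ {N} → Adj N → List (Map N) → Set
Reciprocal {N} adj K = ∀ (x : ℕ) → fromℕ (P adj K x) ≡ ((- 1ℚ) ^ N) * F K (- fromℕ x)

-- vertex (i , u) of Γ (copy i ∈ Fin m, vertex u of Δ) is  combine i u : Fin (m * n)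
copiesAdj : ∀ {n} (m : ℕ) → Adj n → Adj (m ℕ.* n)
copiesAdj {n} m adj v w with remQuot {m} n v | remQuot {m} n w
... | (i , u) | (j , u′) = Dec.does (i ≟ j) ∧ adj u u′
  where import Relation.Nullary.Decidable as Dec

wrAct : ∀ {n m} → Map m → (Fin m → Map n) → Map (m ℕ.* n)
wrAct {n} {m} h gs v with remQuot {m} n v
... | (i , u) = combine (h i) (gs i u)

cons : ∀ {A : Set} {m} → A → (Fin m → A) → Fin (suc m) → A
cons a f zero    = a
cons a f (suc i) = f i

tuples : ∀ {A : Set} → List A → (m : ℕ) → List (Fin m → A)
tuples xs zero    = (λ ()) ∷ []
tuples xs (suc m) = concatMap (λ a → map (cons a) (tuples xs m)) xs

wreath : ∀ {n m} → PermGroup n → PermGroup m → List (Map (m ℕ.* n))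
wreath {n} {m} G H =
  concatMap (λ h → map (wrAct h) (tuples (elems G) m)) (elems H)

order-nonZero : ∀ {n} (K : PermGroup n) → ℕ.NonZero (order K)
order-nonZero K with elems K | hasId K
... | _ ∷ _ | _ = _

_÷order_ : ∀ {n} → ℕ → PermGroup n → ℚ
k ÷order K = _/_ (+ k) (order K) {{order-nonZero K}}

-- Fix h ∈ H and cut copy 0 of Δ out of the wreath product element
-- (h; g₀, …, g_{m-1}), giving an element of the wreath product with m - 1
-- copies. If h fixes copy 0 then Γ/(h;gs) is the disjoint union of
-- Δ/g₀ and the smaller quotient, so its chromatic polynomial factors;
-- otherwise a proper colouring of copy 0 is forced by the copy h 0, and g₀ is
-- composed into the label of the copy sent to copy 0. Since g ↦ g₀ g permutes
-- G, summing over G^m and inducting on m gives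
--   Σ_{gs ∈ G^m} P_{Γ/(h;gs)}(x) = |G|^m (P_{Δ,G}(x)/|G|)^{c(h)}.
-- The weights z^{c(σ)} obey the same recurrences, so
-- F_{G≀H}(z) = |G|^m F_H(F_G(z)/|G|). At z = -x, reciprocity of (Δ,G) gives
-- F_G(-x) = (-1)^n P_{Δ,G}(x), and for even h the sign (-1)^{n c(h)} equals
-- (-1)^{nm} because c(h) + inv(h) ≡ m (mod 2).
-- Cycle counts are recovered from the number 2^{c(σ)} of 2-colourings of the
-- edgeless quotient, and the parity relation from the same splice recursion.

module Submission where

open import Algebra.Bundles using (CommutativeSemiring)

module ListSum {c ℓ} (R : CommutativeSemiring c ℓ) where
  open import Data.Empty using (⊥-elim)
  open import Data.List using (List; []; _∷_; _++_; map; concatMap; foldr; length)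
  open import Data.List.Properties using (length-removeAt′)
  open import Data.List.Relation.Unary.All as All using (All; []; _∷_)
  import Data.List.Relation.Unary.All.Properties as All
  open import Data.List.Relation.Unary.Any as Any using (Any; here; there)
  open import Data.List.Relation.Unary.AllPairs using (AllPairs; []; _∷_)
  import Data.Nat as ℕ
  import Data.Nat.Properties as ℕ
  open import Data.Product using (_,_)
  open import Function using (_∘_)
  open import Relation.Binary.Definitions using (Symmetric; Transitive; Decidable)
  import Relation.Binary.PropositionalEquality as P
  open import Relation.Nullary using (¬_; yes; no)

  open CommutativeSemiring R
  open import Algebra.Properties.CommutativeSemigroup +-commutativeSemigroup using (interchange)

  private variable
    A B : Set

  ∑ : (A → Carrier) → List A → Carrier
  ∑ f []       = 0#
  ∑ f (x ∷ xs) = f x + ∑ f xs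

  ∑-as-foldr : ∀ (f : A → Carrier) xs → ∑ f xs ≈ foldr _+_ 0# (map f xs)
  ∑-as-foldr f []       = refl
  ∑-as-foldr f (x ∷ xs) = +-congˡ (∑-as-foldr f xs)

  ∑-cong-All : ∀ {f g : A → Carrier} {xs} → All (λ x → f x ≈ g x) xs → ∑ f xs ≈ ∑ g xs
  ∑-cong-All []       = refl
  ∑-cong-All (e ∷ es) = +-cong e (∑-cong-All es)

  ∑-cong : ∀ {f g : A → Carrier} → (∀ x → f x ≈ g x) → ∀ xs → ∑ f xs ≈ ∑ g xs
  ∑-cong e []       = refl
  ∑-cong e (x ∷ xs) = +-cong (e x) (∑-cong e xs)

  ∑-map : ∀ (f : B → Carrier) (g : A → B) xs → ∑ f (map g xs) ≈ ∑ (f ∘ g) xs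
  ∑-map f g []       = refl
  ∑-map f g (x ∷ xs) = +-congˡ (∑-map f g xs)

  ∑-++ : ∀ (f : A → Carrier) xs ys → ∑ f (xs ++ ys) ≈ ∑ f xs + ∑ f ys
  ∑-++ f []       ys = sym (+-identityˡ _)
  ∑-++ f (x ∷ xs) ys = trans (+-congˡ (∑-++ f xs ys)) (sym (+-assoc _ _ _))

  ∑-concatMap : ∀ (f : B → Carrier) (g : A → List B) xs →
                ∑ f (concatMap g xs) ≈ ∑ (λ x → ∑ f (g x)) xs
  ∑-concatMap f g []       = refl
  ∑-concatMap f g (x ∷ xs) = trans (∑-++ f (g x) _) (+-congˡ (∑-concatMap f g xs))

  ∑-zero : ∀ (xs : List A) → ∑ (λ _ → 0#) xs ≈ 0#
  ∑-zero []       = refl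
  ∑-zero (x ∷ xs) = trans (+-congˡ (∑-zero xs)) (+-identityʳ 0#)

  ∑-distrib-+ : ∀ (f g : A → Carrier) xs → ∑ (λ x → f x + g x) xs ≈ ∑ f xs + ∑ g xs
  ∑-distrib-+ f g []       = sym (+-identityʳ 0#)
  ∑-distrib-+ f g (x ∷ xs) = trans (+-congˡ (∑-distrib-+ f g xs)) (interchange _ _ _ _)

  *-distribˡ-∑ : ∀ a (f : A → Carrier) xs → a * ∑ f xs ≈ ∑ (λ x → a * f x) xs
  *-distribˡ-∑ a f []       = zeroʳ a
  *-distribˡ-∑ a f (x ∷ xs) = trans (distribˡ a _ _) (+-congˡ (*-distribˡ-∑ a f xs))

  *-distribʳ-∑ : ∀ a (f : A → Carrier) xs → ∑ f xs * a ≈ ∑ (λ x → f x * a) xs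
  *-distribʳ-∑ a f []       = zeroˡ a
  *-distribʳ-∑ a f (x ∷ xs) = trans (distribʳ a _ _) (+-congˡ (*-distribʳ-∑ a f xs))

  ∑-comm : ∀ (f : A → B → Carrier) xs ys →
           ∑ (λ x → ∑ (f x) ys) xs ≈ ∑ (λ y → ∑ (λ x → f x y) xs) ys
  ∑-comm f []       ys = sym (∑-zero ys)
  ∑-comm f (x ∷ xs) ys = trans (+-congˡ (∑-comm f xs ys)) (sym (∑-distrib-+ (f x) _ ys))

  ∑-*-∑ : ∀ (f : A → Carrier) (g : B → Carrier) xs ys →
          ∑ f xs * ∑ g ys ≈ ∑ (λ x → ∑ (λ y → f x * g y) ys) xs
  ∑-*-∑ f g xs ys = trans (*-distribʳ-∑ _ f xs) (∑-cong (λ x → *-distribˡ-∑ (f x) g ys) xs)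

  module Reindex {A : Set} {_∼_ : A → A → Set} (∼-sym : Symmetric _∼_) (∼-trans : Transitive _∼_)
                 (_∼?_ : Decidable _∼_) where

    _∈∼_ : A → List A → Set
    x ∈∼ ys = Any (_∼ x) ys

    Distinct : List A → Set
    Distinct = AllPairs (λ a b → ¬ a ∼ b)

    private
      ∑-─ : ∀ (U : A → Carrier) → (∀ {a b} → a ∼ b → U a ≈ U b) →
            ∀ {x ys} (p : x ∈∼ ys) → ∑ U ys ≈ U x + ∑ U (ys Any.─ p)
      ∑-─ U U-resp (here y∼x)           = +-congʳ (U-resp y∼x)
      ∑-─ U U-resp {x} {y ∷ ys} (there p) =
        trans (+-congˡ (∑-─ U U-resp p)) (trans (sym (+-assoc _ _ _)) (trans (+-congʳ (+-comm _ _)) (+-assoc _ _ _)))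

      Distinct-─ : ∀ {x ys} (p : x ∈∼ ys) → Distinct ys → Distinct (ys Any.─ p)
      Distinct-─ (here _)  (_ ∷ d)      = d
      Distinct-─ (there p) (y≁ ∷ d) = All.─⁺ p y≁ ∷ Distinct-─ p d

      ─-≁ : ∀ {x ys} (p : x ∈∼ ys) → Distinct ys → All (λ z → ¬ z ∼ x) (ys Any.─ p)
      ─-≁ (here y∼x)  (y≁ ∷ _) = All.map (λ y≁z z∼x → y≁z (∼-trans y∼x (∼-sym z∼x))) y≁
      ─-≁ (there p) (y≁ ∷ d)  =
        (λ y∼x → let y≁w , w∼x = All.lookupAny y≁ p in y≁w (∼-trans y∼x (∼-sym w∼x))) ∷ ─-≁ p d

      ∈∼-∷⁻ : ∀ {x xs z} → z ∈∼ (x ∷ xs) → ¬ z ∼ x → z ∈∼ xs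
      ∈∼-∷⁻ (here x∼z)  z≁x = ⊥-elim (z≁x (∼-sym x∼z))
      ∈∼-∷⁻ (there z∈) z≁x = z∈

      All-∈∼-∷⁻ : ∀ {x xs ys} → ¬ x ∈∼ ys → All (_∈∼ (x ∷ xs)) ys → All (_∈∼ xs) ys
      All-∈∼-∷⁻ x∉ []         = []
      All-∈∼-∷⁻ x∉ (y∈ ∷ ys∈) = ∈∼-∷⁻ y∈ (x∉ ∘ here) ∷ All-∈∼-∷⁻ (x∉ ∘ there) ys∈

      All-∈∼-─ : ∀ {x xs ys} (p : x ∈∼ ys) → Distinct ys → All (_∈∼ (x ∷ xs)) ys → All (_∈∼ xs) (ys Any.─ p)
      All-∈∼-─ p d ys∈ = All.zipWith (λ (z∈ , z≁x) → ∈∼-∷⁻ z∈ z≁x) (All.─⁺ p ys∈ , ─-≁ p d)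

    length-≤ : ∀ xs ys → Distinct ys → All (_∈∼ xs) ys → length ys ℕ.≤ length xs
    length-≤ []       []       d ys∈        = ℕ.z≤n
    length-≤ []       (y ∷ ys) d (() ∷ _)
    length-≤ (x ∷ xs) ys       d ys∈ with Any.any? (_∼? x) ys
    ... | yes p = ℕ.≤-trans (ℕ.≤-reflexive (length-removeAt′ ys (Any.index p)))
                            (ℕ.s≤s (length-≤ xs (ys Any.─ p) (Distinct-─ p d) (All-∈∼-─ p d ys∈)))
    ... | no x∉ = ℕ.m≤n⇒m≤1+n (length-≤ xs ys d (All-∈∼-∷⁻ x∉ ys∈))

    ∑-reindex : ∀ (U : A → Carrier) → (∀ {a b} → a ∼ b → U a ≈ U b) →
                ∀ xs ys → Distinct ys → All (_∈∼ xs) ys → length xs ℕ.≤ length ys → ∑ U ys ≈ ∑ U xs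
    ∑-reindex U U-resp []       []       d ys∈ ≤ = refl
    ∑-reindex U U-resp []       (y ∷ ys) d (() ∷ _) ≤
    ∑-reindex U U-resp (x ∷ xs) ys       d ys∈ ≤ with Any.any? (_∼? x) ys
    ... | yes p = trans (∑-─ U U-resp p) (+-congˡ (∑-reindex U U-resp xs (ys Any.─ p) (Distinct-─ p d) (All-∈∼-─ p d ys∈)
                    (ℕ.≤-pred (ℕ.≤-trans ≤ (ℕ.≤-reflexive (length-removeAt′ ys (Any.index p)))))))
    ... | no x∉ = ⊥-elim (ℕ.<-irrefl P.refl (ℕ.≤-trans ≤ (length-≤ xs ys d (All-∈∼-∷⁻ x∉ ys∈))))

module Counting where
  open import Data.Bool using (if_then_else_)
  open import Data.Empty using (⊥-elim)
  open import Data.Fin using (Fin; zero; suc)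
  open import Data.Fin.Properties using (_≟_; suc-injective)
  open import Data.List using (List; []; _∷_; length; filter; allFin)
  open import Data.List.Properties using (map-tabulate; length-tabulate)
  open import Data.Nat using (ℕ; zero; suc; _+_; _*_)
  open import Data.Nat.Properties using (+-*-commutativeSemiring; +-identityʳ)
  open import Data.Product using (_×_; proj₁; proj₂)
  open import Function using (_∘_; id)
  open import Relation.Binary.PropositionalEquality
  open import Relation.Binary.Definitions using (DecidableEquality)
  open import Relation.Nullary using (Dec; yes; no; does; ¬_)

  open ListSum +-*-commutativeSemiring public

  private variable
    A : Set
    P Q R : Set

  indicator : Dec P → ℕ
  indicator d = if does d then 1 else 0

  indicator-yes : (d : Dec P) → P → indicator d ≡ 1
  indicator-yes (yes _) p = refl
  indicator-yes (no ¬p) p = ⊥-elim (¬p p)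

  indicator-no : (d : Dec P) → ¬ P → indicator d ≡ 0
  indicator-no (yes p) ¬p = ⊥-elim (¬p p)
  indicator-no (no _)  ¬p = refl

  indicator-cong : (d : Dec P) (e : Dec Q) → (P → Q) → (Q → P) → indicator d ≡ indicator e
  indicator-cong (yes p) (yes q) to from = refl
  indicator-cong (yes p) (no ¬q) to from = ⊥-elim (¬q (to p))
  indicator-cong (no ¬p) (yes q) to from = ⊥-elim (¬p (from q))
  indicator-cong (no ¬p) (no ¬q) to from = refl

  indicator-× : (d : Dec P) (e : Dec Q) (r : Dec R) →
                (R → P × Q) → (P → Q → R) → indicator r ≡ indicator d * indicator e
  indicator-× (yes p) (yes q) r to from = indicator-yes r (from p q)
  indicator-× (yes p) (no ¬q) r to from = indicator-no r (¬q ∘ proj₂ ∘ to)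
  indicator-× (no ¬p) e       r to from = indicator-no r (¬p ∘ proj₁ ∘ to)

  length-filter : ∀ {P : A → Set} (P? : ∀ x → Dec (P x)) xs →
                  length (filter P? xs) ≡ ∑ (indicator ∘ P?) xs
  length-filter P? []       = refl
  length-filter P? (x ∷ xs) with P? x
  ... | yes _ = cong suc (length-filter P? xs)
  ... | no _  = length-filter P? xs

  ∑-const : ∀ c (xs : List A) → ∑ (λ _ → c) xs ≡ length xs * c
  ∑-const c []       = refl
  ∑-const c (x ∷ xs) = cong (c +_) (∑-const c xs)

  ∑-allFin-const : ∀ {n} c → ∑ (λ (_ : Fin n) → c) (allFin n) ≡ n * c
  ∑-allFin-const {n} c = trans (∑-const c (allFin n)) (cong (_* c) (length-tabulate {n = n} id))

  ∑-allFin-suc : ∀ {n} (f : Fin (suc n) → ℕ) → ∑ f (allFin (suc n)) ≡ f zero + ∑ (f ∘ suc) (allFin n)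
  ∑-allFin-suc {n} f = trans (cong (λ xs → f zero + ∑ f xs) (sym (map-tabulate id suc)))
                             (cong (f zero +_) (∑-map f suc (allFin n)))

  ∑-allFin-≟ : ∀ {n} (t : Fin n) → ∑ (λ c → indicator (c ≟ t)) (allFin n) ≡ 1
  ∑-allFin-≟ {suc n} zero = begin
    ∑ (λ c → indicator (c ≟ zero)) (allFin (suc n))     ≡⟨ ∑-allFin-suc {n} (λ c → indicator (c ≟ zero)) ⟩
    1 + ∑ (λ c → indicator (suc c ≟ zero)) (allFin n)   ≡⟨ cong suc (∑-cong (λ c → indicator-no (suc c ≟ zero) λ ()) (allFin n)) ⟩
    1 + ∑ (λ _ → 0) (allFin n)                          ≡⟨ cong suc (∑-zero (allFin n)) ⟩
    1                                                   ∎
    where open ≡-Reasoning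
  ∑-allFin-≟ {suc n} (suc t) = begin
    ∑ (λ c → indicator (c ≟ suc t)) (allFin (suc n))    ≡⟨ ∑-allFin-suc {n} (λ c → indicator (c ≟ suc t)) ⟩
    0 + ∑ (λ c → indicator (suc c ≟ suc t)) (allFin n)
      ≡⟨ ∑-cong (λ c → indicator-cong (suc c ≟ suc t) (c ≟ t) suc-injective (cong suc)) (allFin n) ⟩
    ∑ (λ c → indicator (c ≟ t)) (allFin n)              ≡⟨ ∑-allFin-≟ t ⟩
    1                                                   ∎
    where open ≡-Reasoning

  ∑-indicator-≡ : ∀ {B : Set} (_≟ᴬ_ : DecidableEquality A) (us : List A) →
                  (∀ v → ∑ (λ u → indicator (u ≟ᴬ v)) us ≡ 1) →
                  ∀ (φ : B → A) (g : B → ℕ) ts → ∑ (λ u → ∑ (λ t → indicator (u ≟ᴬ φ t) * g t) ts) us ≡ ∑ g ts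
  ∑-indicator-≡ _≟ᴬ_ us once φ g ts = trans (∑-comm _ us ts) (∑-cong (λ t →
    trans (sym (*-distribʳ-∑ (g t) (λ u → indicator (u ≟ᴬ φ t)) us))
          (trans (cong (_* g t) (once (φ t))) (+-identityʳ (g t)))) ts)

module Colourings where
  open import Data.Fin using (Fin)
  open import Data.Fin.Properties using (_≟_)
  open import Data.List using (map; allFin)
  open import Data.Nat using (ℕ; zero; suc; _+_; _*_)
  open import Data.Nat.Properties using (+-identityʳ)
  open import Data.Vec using (Vec; []; _∷_; _++_)
  open import Data.Vec.Properties using (∷-injective)
  import Data.Vec.Properties as Vec
  open import Relation.Binary.PropositionalEquality
  open import Relation.Nullary using (Dec)

  open import Defs using (allVecs)
  open Counting

  _≟ᵥ_ : ∀ {y N} (u v : Vec (Fin y) N) → Dec (u ≡ v)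
  _≟ᵥ_ = Vec.≡-dec _≟_

  ∑-allVecs-∷ : ∀ y N (w : Vec (Fin y) (suc N) → ℕ) →
                ∑ w (allVecs y (suc N)) ≡ ∑ (λ c → ∑ (λ v → w (c ∷ v)) (allVecs y N)) (allFin y)
  ∑-allVecs-∷ y N w = trans (∑-concatMap w (λ c → map (c ∷_) (allVecs y N)) (allFin y))
                            (∑-cong (λ c → ∑-map w (c ∷_) (allVecs y N)) (allFin y))

  ∑-allVecs-++ : ∀ y a b (w : Vec (Fin y) (a + b) → ℕ) →
                 ∑ w (allVecs y (a + b)) ≡ ∑ (λ u → ∑ (λ v → w (u ++ v)) (allVecs y b)) (allVecs y a)
  ∑-allVecs-++ y zero    b w = sym (+-identityʳ _)
  ∑-allVecs-++ y (suc a) b w = begin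
    ∑ w (allVecs y (suc (a + b)))
      ≡⟨ ∑-allVecs-∷ y (a + b) w ⟩
    ∑ (λ c → ∑ (λ v → w (c ∷ v)) (allVecs y (a + b))) (allFin y)
      ≡⟨ ∑-cong (λ c → ∑-allVecs-++ y a b (λ v → w (c ∷ v))) (allFin y) ⟩
    ∑ (λ c → ∑ (λ u → ∑ (λ v → w (c ∷ u ++ v)) (allVecs y b)) (allVecs y a)) (allFin y)
      ≡⟨ ∑-allVecs-∷ y a _ ⟨
    ∑ (λ u → ∑ (λ v → w (u ++ v)) (allVecs y b)) (allVecs y (suc a)) ∎
    where open ≡-Reasoning

  ∑-allVecs-≟ : ∀ y N (t : Vec (Fin y) N) → ∑ (λ u → indicator (u ≟ᵥ t)) (allVecs y N) ≡ 1
  ∑-allVecs-≟ y zero    []       = refl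
  ∑-allVecs-≟ y (suc N) (t ∷ ts) = begin
    ∑ (λ u → indicator (u ≟ᵥ (t ∷ ts))) (allVecs y (suc N))
      ≡⟨ ∑-allVecs-∷ y N _ ⟩
    ∑ (λ c → ∑ (λ v → indicator ((c ∷ v) ≟ᵥ (t ∷ ts))) (allVecs y N)) (allFin y)
      ≡⟨ ∑-cong (λ c → ∑-cong (λ v → indicator-× (c ≟ t) (v ≟ᵥ ts) ((c ∷ v) ≟ᵥ (t ∷ ts))
                                        ∷-injective (cong₂ _∷_)) (allVecs y N)) (allFin y) ⟩
    ∑ (λ c → ∑ (λ v → indicator (c ≟ t) * indicator (v ≟ᵥ ts)) (allVecs y N)) (allFin y)
      ≡⟨ ∑-*-∑ _ _ (allFin y) (allVecs y N) ⟨
    ∑ (λ c → indicator (c ≟ t)) (allFin y) * ∑ (λ v → indicator (v ≟ᵥ ts)) (allVecs y N)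
      ≡⟨ cong₂ _*_ (∑-allFin-≟ t) (∑-allVecs-≟ y N ts) ⟩
    1 ∎
    where open ≡-Reasoning

module Iteration where
  open import Data.Fin using (Fin; zero; suc; toℕ; fromℕ<)
  open import Data.Fin.Properties using (pigeonhole; toℕ<n; toℕ-fromℕ<; toℕ-injective)
  open import Data.Nat using (ℕ; zero; suc; _+_; _*_; _∸_; _≤_; _<_; _≤?_)
  open import Data.Nat.DivMod using (_%_; _/_; m≡m%n+[m/n]*n; m%n<n)
  open import Data.Nat.Properties
  open import Data.Product using (Σ; _×_; _,_; proj₁; proj₂)
  open import Function using (_∘_)
  open import Function.Definitions using (Injective)
  open import Relation.Binary.PropositionalEquality
  open import Relation.Nullary using (yes; no)

  open import Defs using (Map; iter; IsCycleMin)

  module _ {N : ℕ} (σ : Map N) where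

    iter-+ : ∀ a b x → iter σ (a + b) x ≡ iter σ a (iter σ b x)
    iter-+ zero    b x = refl
    iter-+ (suc a) b x = cong σ (iter-+ a b x)

    iter-sucʳ : ∀ k x → iter σ k (σ x) ≡ iter σ (suc k) x
    iter-sucʳ zero    x = refl
    iter-sucʳ (suc k) x = cong σ (iter-sucʳ k x)

    iter-injective : Injective _≡_ _≡_ σ → ∀ k → Injective _≡_ _≡_ (iter σ k)
    iter-injective inj zero    e = e
    iter-injective inj (suc k) e = iter-injective inj k (inj e)

    iter-periodic : ∀ p x → iter σ p x ≡ x → ∀ q → iter σ (q * p) x ≡ x
    iter-periodic p x e zero    = refl
    iter-periodic p x e (suc q) = trans (iter-+ p (q * p) x) (trans (cong (iter σ p) (iter-periodic p x e q)) e)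

    iter-cong : ∀ {τ : Map N} → (∀ i → σ i ≡ τ i) → ∀ k x → iter σ k x ≡ iter τ k x
    iter-cong e zero    x = refl
    iter-cong {τ} e (suc k) x = trans (e _) (cong τ (iter-cong e k x))

  argmin : ∀ {K} (g : Fin (suc K) → ℕ) → Σ (Fin (suc K)) λ k → ∀ k′ → g k ≤ g k′
  argmin {zero}  g = zero , λ { zero → ≤-refl }
  argmin {suc K} g with argmin (g ∘ suc)
  ... | k , k-min with g zero ≤? g (suc k)
  ...   | yes g0≤ = zero  , λ { zero → ≤-refl ; (suc k′) → ≤-trans g0≤ (k-min k′) }
  ...   | no g0≰  = suc k , λ { zero → <⇒≤ (≰⇒> g0≰) ; (suc k′) → k-min k′ }

  module CycleRep {N′ : ℕ} (σ : Map (suc N′)) (σ-inj : Injective _≡_ _≡_ σ) where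

    private
      N = suc N′

    period : ∀ x → Σ ℕ λ p → 0 < p × p ≤ N × iter σ p x ≡ x
    period x with pigeonhole (n<1+n N) (λ (k : Fin (suc N)) → iter σ (toℕ k) x)
    ... | i , j , i<j , σⁱx≡σʲx =
      toℕ j ∸ toℕ i , m<n⇒0<n∸m i<j , ≤-trans (m∸n≤m (toℕ j) (toℕ i)) (≤-pred (toℕ<n j)) ,
      iter-injective σ σ-inj (toℕ i) (begin
        iter σ (toℕ i) (iter σ (toℕ j ∸ toℕ i) x) ≡⟨ iter-+ σ (toℕ i) _ x ⟨
        iter σ (toℕ i + (toℕ j ∸ toℕ i)) x       ≡⟨ cong (λ t → iter σ t x) (m+[n∸m]≡n (<⇒≤ i<j)) ⟩
        iter σ (toℕ j) x                         ≡⟨ σⁱx≡σʲx ⟨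
        iter σ (toℕ i) x                         ∎)
      where open ≡-Reasoning

    iter-reduce : ∀ x k → Σ (Fin N) λ k′ → iter σ k x ≡ iter σ (toℕ k′) x
    iter-reduce x k with period x
    ... | suc p′ , _ , p≤N , σᵖx≡x = fromℕ< r<N , (begin
      iter σ k x                         ≡⟨ cong (λ t → iter σ t x) (m≡m%n+[m/n]*n k p) ⟩
      iter σ (k % p + (k / p) * p) x     ≡⟨ iter-+ σ (k % p) ((k / p) * p) x ⟩
      iter σ (k % p) (iter σ ((k / p) * p) x) ≡⟨ cong (iter σ (k % p)) (iter-periodic σ p x σᵖx≡x (k / p)) ⟩
      iter σ (k % p) x                   ≡⟨ cong (λ t → iter σ t x) (toℕ-fromℕ< r<N) ⟨
      iter σ (toℕ (fromℕ< r<N)) x        ∎)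
      where
      open ≡-Reasoning
      p = suc p′
      r<N : k % p < N
      r<N = ≤-trans (m%n<n k p) p≤N

    private
      minExponent : Fin N → Fin N
      minExponent x = proj₁ (argmin (λ k → toℕ (iter σ (toℕ k) x)))

    rep : Fin N → Fin N
    rep x = iter σ (toℕ (minExponent x)) x

    rep-minimal : ∀ x k → toℕ (rep x) ≤ toℕ (iter σ k x)
    rep-minimal x k with iter-reduce x k
    ... | k′ , e rewrite e = proj₂ (argmin (λ k → toℕ (iter σ (toℕ k) x))) k′

    rep-unique : ∀ x y a → y ≡ iter σ a x → (∀ k → toℕ y ≤ toℕ (iter σ k x)) → rep x ≡ y
    rep-unique x y a y≡ y-min = toℕ-injective (≤-antisym
      (subst (λ t → toℕ (rep x) ≤ toℕ t) (sym y≡) (rep-minimal x a))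
      (y-min (toℕ (minExponent x))))

    rep-σ : ∀ x → rep (σ x) ≡ rep x
    rep-σ x with period x
    ... | suc p′ , _ , _ , σᵖx≡x = rep-unique (σ x) (rep x) (e + p′) (sym (begin
      iter σ (e + p′) (σ x)           ≡⟨ iter-sucʳ σ (e + p′) x ⟩
      iter σ (suc (e + p′)) x         ≡⟨ cong (λ t → iter σ t x) (+-suc e p′) ⟨
      iter σ (e + suc p′) x           ≡⟨ iter-+ σ e (suc p′) x ⟩
      iter σ e (iter σ (suc p′) x)    ≡⟨ cong (iter σ e) σᵖx≡x ⟩
      rep x                           ∎))
      (λ k → subst (λ t → toℕ (rep x) ≤ toℕ t) (sym (iter-sucʳ σ k x)) (rep-minimal x (suc k)))
      where
      open ≡-Reasoning
      e = toℕ (minExponent x)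

    rep≡⇒IsCycleMin : ∀ x → rep x ≡ x → IsCycleMin σ x
    rep≡⇒IsCycleMin x e k = subst (λ t → toℕ t ≤ toℕ (iter σ (toℕ k) x)) e (rep-minimal x (toℕ k))

    IsCycleMin⇒rep≡ : ∀ x → IsCycleMin σ x → rep x ≡ x
    IsCycleMin⇒rep≡ x x-min = rep-unique x x 0 refl λ k →
      let k′ , e = iter-reduce x k in subst (λ t → toℕ x ≤ toℕ t) (sym e) (x-min k′)

    rep-≤ : ∀ x → toℕ (rep x) ≤ toℕ x
    rep-≤ x = rep-minimal x 0

    invariant-rep : ∀ {A : Set} (f : Fin N → A) → (∀ v → f (σ v) ≡ f v) → ∀ x → f (rep x) ≡ f x
    invariant-rep f f-inv x = along (toℕ (minExponent x))
      where
      along : ∀ k → f (iter σ k x) ≡ f x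
      along zero    = refl
      along (suc k) = trans (f-inv _) (along k)

module Constraints where
  open import Data.Empty using (⊥-elim)
  open import Data.Fin using (Fin; zero; suc; toℕ)
  open import Data.Fin.Properties using (_≟_; all?)
  open import Data.List using (allFin)
  open import Data.Nat using (ℕ; zero; suc; _+_; _*_; _^_; _<_; s≤s)
  open import Data.Nat.Properties using (^-distribˡ-+-*; n≮0)
  open import Data.Product using (_×_; _,_)
  open import Data.Unit using (⊤; tt)
  open import Data.Empty using (⊥)
  open import Data.Vec using (Vec; []; _∷_; lookup)
  open import Function using (_∘_)
  open import Relation.Binary.PropositionalEquality
  open import Relation.Nullary using (Dec; yes; no)

  open import Defs using (allVecs)
  open Counting
  open Colourings

  data Constraint (y N : ℕ) : Set where
    free  : Constraint y N
    fixed : Fin y → Constraint y N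
    copy  : Fin N → Constraint y N

  private variable
    y N M : ℕ

  Holds : Constraint y N → Vec (Fin y) N → Fin y → Set
  Holds free      f c = ⊤
  Holds (fixed d) f c = c ≡ d
  Holds (copy k)  f c = c ≡ lookup f k

  holds? : (l : Constraint y N) (f : Vec (Fin y) N) (c : Fin y) → Dec (Holds l f c)
  holds? free      f c = yes tt
  holds? (fixed d) f c = c ≟ d
  holds? (copy k)  f c = c ≟ lookup f k

  Solution : (Fin N → Constraint y N) → Vec (Fin y) N → Set
  Solution L f = ∀ i → Holds (L i) f (lookup f i)

  solution? : (L : Fin N → Constraint y N) (f : Vec (Fin y) N) → Dec (Solution L f)
  solution? L f = all? (λ i → holds? (L i) f (lookup f i))

  Triangular : (Fin N → Constraint y N) → Set
  Triangular L = ∀ i k → L i ≡ copy k → toℕ k < toℕ i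

  isFree : Constraint y N → ℕ
  isFree free      = 1
  isFree (fixed _) = 0
  isFree (copy _)  = 0

  #free : (Fin N → Constraint y M) → ℕ
  #free {N = N} L = ∑ (isFree ∘ L) (allFin N)

  #free-suc : (L : Fin (suc N) → Constraint y M) → #free L ≡ isFree (L zero) + #free (L ∘ suc)
  #free-suc L = ∑-allFin-suc (isFree ∘ L)

  substZero : Fin y → Constraint y (suc N) → Constraint y N
  substZero c free           = free
  substZero c (fixed d)      = fixed d
  substZero c (copy zero)    = fixed c
  substZero c (copy (suc k)) = copy k

  isFree-substZero : (c : Fin y) (l : Constraint y (suc N)) → isFree (substZero c l) ≡ isFree l
  isFree-substZero c free           = refl
  isFree-substZero c (fixed d)      = refl
  isFree-substZero c (copy zero)    = refl
  isFree-substZero c (copy (suc k)) = refl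

  Holds-substZero⁺ : ∀ (c : Fin y) (l : Constraint y (suc N)) f v → Holds l (c ∷ f) v → Holds (substZero c l) f v
  Holds-substZero⁺ c free           f v h = h
  Holds-substZero⁺ c (fixed d)      f v h = h
  Holds-substZero⁺ c (copy zero)    f v h = h
  Holds-substZero⁺ c (copy (suc k)) f v h = h

  Holds-substZero⁻ : ∀ (c : Fin y) (l : Constraint y (suc N)) f v → Holds (substZero c l) f v → Holds l (c ∷ f) v
  Holds-substZero⁻ c free           f v h = h
  Holds-substZero⁻ c (fixed d)      f v h = h
  Holds-substZero⁻ c (copy zero)    f v h = h
  Holds-substZero⁻ c (copy (suc k)) f v h = h

  tail-system : Fin y → (Fin (suc N) → Constraint y (suc N)) → Fin N → Constraint y N
  tail-system c L = substZero c ∘ L ∘ suc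

  tail-system-triangular : ∀ c (L : Fin (suc N) → Constraint y (suc N)) → Triangular L → Triangular (tail-system c L)
  tail-system-triangular c L tri j k e with L (suc j) in eq
  tail-system-triangular c L tri j k () | free
  tail-system-triangular c L tri j k () | fixed d
  tail-system-triangular c L tri j k () | copy zero
  tail-system-triangular c L tri j k refl | copy (suc k) with tri (suc j) (suc k) eq
  ... | s≤s k<j = k<j

  #free-tail-system : ∀ c (L : Fin (suc N) → Constraint y (suc N)) → #free (tail-system c L) ≡ #free (L ∘ suc)
  #free-tail-system {N = N} c L = ∑-cong (λ j → isFree-substZero c (L (suc j))) (allFin N)

  HoldsAtZero : Constraint y N → Fin y → Set
  HoldsAtZero free      c = ⊤
  HoldsAtZero (fixed d) c = c ≡ d
  HoldsAtZero (copy _)  c = ⊥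

  holdsAtZero? : (l : Constraint y N) (c : Fin y) → Dec (HoldsAtZero l c)
  holdsAtZero? free      c = yes tt
  holdsAtZero? (fixed d) c = c ≟ d
  holdsAtZero? (copy _)  c = no λ ()

  HoldsAtZero⁺ : (l : Constraint y (suc N)) → (∀ k → l ≢ copy k) → ∀ c f → Holds l (c ∷ f) c → HoldsAtZero l c
  HoldsAtZero⁺ free      _      c f h = tt
  HoldsAtZero⁺ (fixed d) _      c f h = h
  HoldsAtZero⁺ (copy k)  ¬copy c f h = ⊥-elim (¬copy k refl)

  HoldsAtZero⁻ : (l : Constraint y (suc N)) → ∀ c f → HoldsAtZero l c → Holds l (c ∷ f) c
  HoldsAtZero⁻ free      c f h = tt
  HoldsAtZero⁻ (fixed d) c f h = h

  #solutionsAtZero : (l : Constraint y N) → (∀ k → l ≢ copy k) →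
                     ∑ (λ c → indicator (holdsAtZero? l c)) (allFin y) ≡ y ^ isFree l
  #solutionsAtZero {y} free      _      = ∑-allFin-const {y} 1
  #solutionsAtZero {y} (fixed d) _      = ∑-allFin-≟ d
  #solutionsAtZero {y} (copy k)  ¬copy = ⊥-elim (¬copy k refl)

  Solution-∷⁺ : ∀ (L : Fin (suc N) → Constraint y (suc N)) → Triangular L → ∀ c f →
                Solution L (c ∷ f) → HoldsAtZero (L zero) c × Solution (tail-system c L) f
  Solution-∷⁺ L tri c f s =
    HoldsAtZero⁺ (L zero) (λ k e → n≮0 (tri zero k e)) c f (s zero) ,
    λ j → Holds-substZero⁺ c (L (suc j)) f _ (s (suc j))

  Solution-∷⁻ : ∀ (L : Fin (suc N) → Constraint y (suc N)) c f →
                HoldsAtZero (L zero) c → Solution (tail-system c L) f → Solution L (c ∷ f)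
  Solution-∷⁻ L c f h s zero    = HoldsAtZero⁻ (L zero) c f h
  Solution-∷⁻ L c f h s (suc j) = Holds-substZero⁻ c (L (suc j)) f _ (s j)

  #solutions : ∀ y N (L : Fin N → Constraint y N) → Triangular L →
               ∑ (λ f → indicator (solution? L f)) (allVecs y N) ≡ y ^ #free L
  #solutions y zero    L tri = cong (_+ 0) (indicator-yes (solution? L []) λ ())
  #solutions y (suc N) L tri = begin
    ∑ (λ f → indicator (solution? L f)) (allVecs y (suc N))
      ≡⟨ ∑-allVecs-∷ y N _ ⟩
    ∑ (λ c → ∑ (λ f → indicator (solution? L (c ∷ f))) (allVecs y N)) (allFin y)
      ≡⟨ ∑-cong (λ c → ∑-cong (λ f → indicator-× (holdsAtZero? (L zero) c) (solution? (tail-system c L) f)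
                         (solution? L (c ∷ f)) (Solution-∷⁺ L tri c f) (Solution-∷⁻ L c f))
                       (allVecs y N)) (allFin y) ⟩
    ∑ (λ c → ∑ (λ f → head c * indicator (solution? (tail-system c L) f)) (allVecs y N)) (allFin y)
      ≡⟨ ∑-cong (λ c → *-distribˡ-∑ (head c) _ (allVecs y N)) (allFin y) ⟨
    ∑ (λ c → head c * ∑ (λ f → indicator (solution? (tail-system c L) f)) (allVecs y N)) (allFin y)
      ≡⟨ ∑-cong (λ c → cong (head c *_)
                   (trans (#solutions y N (tail-system c L) (tail-system-triangular c L tri))
                          (cong (y ^_) (#free-tail-system c L)))) (allFin y) ⟩
    ∑ (λ c → head c * y ^ #free (L ∘ suc)) (allFin y)
      ≡⟨ *-distribʳ-∑ (y ^ #free (L ∘ suc)) head (allFin y) ⟨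
    ∑ head (allFin y) * y ^ #free (L ∘ suc)
      ≡⟨ cong (_* y ^ #free (L ∘ suc)) (#solutionsAtZero (L zero) (λ k e → n≮0 (tri zero k e))) ⟩
    y ^ isFree (L zero) * y ^ #free (L ∘ suc)
      ≡⟨ ^-distribˡ-+-* y (isFree (L zero)) _ ⟨
    y ^ (isFree (L zero) + #free (L ∘ suc))
      ≡⟨ cong (y ^_) (#free-suc L) ⟨
    y ^ #free L ∎
    where
    open ≡-Reasoning
    head : Fin y → ℕ
    head c = indicator (holdsAtZero? (L zero) c)

module Quotients where
  open import Data.Bool using (false; true)
  open import Data.Empty using (⊥-elim)
  open import Data.Fin using (Fin; zero; suc; toℕ)
  open import Data.Fin.Properties using (_≟_; toℕ-injective)
  open import Data.List using (allFin)
  open import Data.Nat using (zero; suc; _+_; _≤_; _^_)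
  open import Data.Nat.Properties using (≤∧≢⇒<)
  open import Data.Product using (_,_)
  open import Data.Unit using (tt)
  open import Data.Vec using (Vec; _∷_; _++_; lookup)
  open import Function using (_∘_)
  open import Function.Definitions using (Injective)
  open import Relation.Binary.PropositionalEquality hiding (_≗_)
  open import Relation.Nullary using (Dec; yes; no)

  open import Defs hiding (_^_)
  open Counting
  open Colourings
  open Iteration
  open Constraints

  chromQuot-∑ : ∀ {N} (adj : Adj N) (g : Map N) y →
                chromQuot adj g y ≡ ∑ (λ f → indicator (properQuot? adj g f)) (allVecs y N)
  chromQuot-∑ {N} adj g y = length-filter (properQuot? adj g) (allVecs y N)

  chromQuot-∑-∷ : ∀ {N} (adj : Adj (suc N)) (g : Map (suc N)) y →
                  chromQuot adj g y ≡ ∑ (λ c → ∑ (λ t → indicator (properQuot? adj g (c ∷ t))) (allVecs y N)) (allFin y)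
  chromQuot-∑-∷ {N} adj g y = trans (chromQuot-∑ adj g y) (∑-allVecs-∷ y N _)

  chromQuot-∑-++ : ∀ {a b} (adj : Adj (a + b)) (g : Map (a + b)) y →
                   chromQuot adj g y ≡ ∑ (λ u → ∑ (λ t → indicator (properQuot? adj g (u ++ t))) (allVecs y b)) (allVecs y a)
  chromQuot-∑-++ {a} {b} adj g y = trans (chromQuot-∑ adj g y) (∑-allVecs-++ y a b _)

  cycles-∑ : ∀ {N} (σ : Map N) → cycles σ ≡ ∑ (λ i → indicator (isCycleMin? σ i)) (allFin N)
  cycles-∑ {N} σ = length-filter (isCycleMin? σ) (allFin N)

  chromQuot-cong : ∀ {N} (adj : Adj N) {σ τ : Map N} → σ ≗ τ → ∀ y → chromQuot adj σ y ≡ chromQuot adj τ y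
  chromQuot-cong {N} adj {σ} {τ} σ≗τ y = trans (chromQuot-∑ adj σ y) (trans
    (∑-cong (λ f → indicator-cong (properQuot? adj σ f) (properQuot? adj τ f)
        (λ (inv , proper) → (λ v → trans (cong (lookup f) (sym (σ≗τ v))) (inv v)) , proper)
        (λ (inv , proper) → (λ v → trans (cong (lookup f) (σ≗τ v)) (inv v)) , proper)) (allVecs y N))
    (sym (chromQuot-∑ adj τ y)))

  cycles-cong : ∀ {N} {σ τ : Map N} → σ ≗ τ → cycles σ ≡ cycles τ
  cycles-cong {N} {σ} {τ} σ≗τ = trans (cycles-∑ σ) (trans
    (∑-cong (λ i → indicator-cong (isCycleMin? σ i) (isCycleMin? τ i)
        (λ min k → subst (λ t → toℕ i ≤ toℕ t) (iter-cong σ σ≗τ (toℕ k) i) (min k))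
        (λ min k → subst (λ t → toℕ i ≤ toℕ t) (sym (iter-cong σ σ≗τ (toℕ k) i)) (min k))) (allFin N))
    (sym (cycles-∑ τ)))

  -- A colouring is constant on the cycles of σ iff each vertex other than a
  -- cycle minimum copies the colour of the (smaller) minimum of its cycle.
  chromQuot-edgeless : ∀ {N} (adj : Adj N) → (∀ u v → adj u v ≡ false) →
                       (σ : Map N) → Injective _≡_ _≡_ σ → ∀ y → chromQuot adj σ y ≡ y ^ cycles σ
  chromQuot-edgeless {zero}   adj no-edge σ σ-inj y = refl
  chromQuot-edgeless {suc N′} adj no-edge σ σ-inj y = begin
    chromQuot adj σ y                                    ≡⟨ chromQuot-∑ adj σ y ⟩
    ∑ (λ f → indicator (properQuot? adj σ f)) (allVecs y N)
      ≡⟨ ∑-cong (λ f → indicator-cong (properQuot? adj σ f) (solution? L f) (to f) (from f)) (allVecs y N) ⟩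
    ∑ (λ f → indicator (solution? L f)) (allVecs y N)    ≡⟨ #solutions y N L triangular ⟩
    y ^ #free L                                          ≡⟨ cong (y ^_) (∑-cong isFree-L (allFin N)) ⟩
    y ^ ∑ (λ i → indicator (isCycleMin? σ i)) (allFin N) ≡⟨ cong (y ^_) (cycles-∑ σ) ⟨
    y ^ cycles σ                                         ∎
    where
    open ≡-Reasoning
    open CycleRep σ σ-inj
    N = suc N′

    constraintAt : (i : Fin N) → Dec (rep i ≡ i) → Constraint y N
    constraintAt i (yes _) = free
    constraintAt i (no _)  = copy (rep i)

    L : Fin N → Constraint y N
    L i = constraintAt i (rep i ≟ i)

    triangular : Triangular L
    triangular i k e with rep i ≟ i
    triangular i k () | yes _
    triangular i k refl | no rep≢i = ≤∧≢⇒< (rep-≤ i) (rep≢i ∘ toℕ-injective)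

    copies-rep : ∀ (f : Vec (Fin y) N) → Solution L f → ∀ i → lookup f i ≡ lookup f (rep i)
    copies-rep f s i with rep i ≟ i | s i
    ... | yes rep≡i | _ = cong (lookup f) (sym rep≡i)
    ... | no _      | h = h

    to : ∀ f → ProperQuotColouring adj σ f → Solution L f
    to f (f-inv , _) i with rep i ≟ i
    ... | yes _ = tt
    ... | no _  = sym (invariant-rep (lookup f) f-inv i)

    from : ∀ f → Solution L f → ProperQuotColouring adj σ f
    from f s = (λ v → trans (copies-rep f s (σ v)) (trans (cong (lookup f) (rep-σ v)) (sym (copies-rep f s v)))) ,
               (λ u v adj≡true → ⊥-elim (false≢true (trans (sym (no-edge u v)) adj≡true)))
      where
      false≢true : false ≢ true
      false≢true ()

    isFree-L : ∀ i → isFree (L i) ≡ indicator (isCycleMin? σ i)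
    isFree-L i with rep i ≟ i
    ... | yes rep≡i = sym (indicator-yes (isCycleMin? σ i) (rep≡⇒IsCycleMin i rep≡i))
    ... | no rep≢i  = sym (indicator-no (isCycleMin? σ i) (rep≢i ∘ IsCycleMin⇒rep≡ i))

module Copies where
  open import Data.Bool using (true; _∧_)
  open import Data.Empty using (⊥-elim)
  open import Data.Fin using (Fin; zero; suc; combine; remQuot)
  open import Data.Fin.Properties using (_≟_; remQuot-combine; combine-remQuot)
  open import Data.Nat using (ℕ; suc; _*_)
  open import Data.Product using (_×_; _,_; proj₁; proj₂)
  open import Data.Vec using (Vec; lookup; _++_)
  open import Data.Vec.Properties using (lookup-++ˡ; lookup-++ʳ)
  open import Relation.Binary.PropositionalEquality hiding (_≗_)
  open import Relation.Nullary using (yes; no; does)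

  open import Defs hiding (_^_)

  module _ {n m : ℕ} where

    wrAct-combine : ∀ (h : Map m) (gs : Fin m → Map n) i j → wrAct h gs (combine i j) ≡ combine (h i) (gs i j)
    wrAct-combine h gs i j = cong (λ (i′ , j′) → combine (h i′) (gs i′ j′)) (remQuot-combine {m} {n} i j)

    wrAct-cong : ∀ (h : Map m) (gs gs′ : Fin m → Map n) → (∀ i → gs i ≗ gs′ i) → wrAct h gs ≗ wrAct h gs′
    wrAct-cong h gs gs′ e v = cong (combine (h i)) (e i j)
      where
      i = proj₁ (remQuot {m} n v)
      j = proj₂ (remQuot {m} n v)

    copiesAdj-combine : ∀ (adj : Adj n) i j i′ j′ →
                        copiesAdj m adj (combine i j) (combine i′ j′) ≡ (does (i ≟ i′) ∧ adj j j′)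
    copiesAdj-combine adj i j i′ j′ =
      cong₂ (λ (i , j) (i′ , j′) → does (i ≟ i′) ∧ adj j j′) (remQuot-combine {m} {n} i j) (remQuot-combine {m} {n} i′ j′)

    combine-elim : ∀ {P : Fin (m * n) → Set} → (∀ i j → P (combine i j)) → ∀ v → P v
    combine-elim {P} p v = subst P (combine-remQuot {m} n v) (p (proj₁ (remQuot {m} n v)) (proj₂ (remQuot {m} n v)))

    block : ∀ {y} → Vec (Fin y) (m * n) → Fin m → Fin n → Fin y
    block f i j = lookup f (combine i j)

    BlockInvariant : ∀ {y} → Map m → (Fin m → Map n) → Vec (Fin y) (m * n) → Set
    BlockInvariant h gs f = ∀ i j → block f (h i) (gs i j) ≡ block f i j

    BlockProper : ∀ {y} → Adj n → Vec (Fin y) (m * n) → Set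
    BlockProper adj f = ∀ i j j′ → adj j j′ ≡ true → block f i j ≢ block f i j′

    ProperQuotColouring-copies⁻ : ∀ {y} adj h gs (f : Vec (Fin y) (m * n)) →
      ProperQuotColouring (copiesAdj m adj) (wrAct h gs) f → BlockInvariant h gs f × BlockProper adj f
    ProperQuotColouring-copies⁻ adj h gs f (f-inv , f-proper) =
      (λ i j → trans (cong (lookup f) (sym (wrAct-combine h gs i j))) (f-inv (combine i j))) ,
      (λ i j j′ e → f-proper (combine i j) (combine i j′) (trans (copiesAdj-combine adj i j i j′) (same-copy i e)))
      where
      same-copy : ∀ i {b} → b ≡ true → (does (i ≟ i) ∧ b) ≡ true
      same-copy i e with i ≟ i
      ... | yes _   = e
      ... | no i≢i  = ⊥-elim (i≢i refl)

    ProperQuotColouring-copies⁺ : ∀ {y} adj h gs (f : Vec (Fin y) (m * n)) →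
      BlockInvariant h gs f → BlockProper adj f → ProperQuotColouring (copiesAdj m adj) (wrAct h gs) f
    ProperQuotColouring-copies⁺ adj h gs f f-inv f-proper =
      combine-elim (λ i j → trans (cong (lookup f) (wrAct-combine h gs i j)) (f-inv i j)) ,
      combine-elim λ i j → combine-elim λ i′ j′ e → proper i j i′ j′ (trans (sym (copiesAdj-combine adj i j i′ j′)) e)
      where
      proper : ∀ i j i′ j′ → (does (i ≟ i′) ∧ adj j j′) ≡ true → block f i j ≢ block f i′ j′
      proper i j i′ j′ e with i ≟ i′ | adj j j′ in adj≡
      ... | yes refl | true = f-proper i j j′ adj≡

  module _ {n m y : ℕ} (u : Vec (Fin y) n) (t : Vec (Fin y) (m * n)) where

    block-++-zero : ∀ j → block {n} {suc m} (u ++ t) zero j ≡ lookup u j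
    block-++-zero j = lookup-++ˡ u t j

    block-++-suc : ∀ i j → block {n} {suc m} (u ++ t) (suc i) j ≡ block {n} {m} t i j
    block-++-suc i j = lookup-++ʳ u t (combine i j)

module Splice where
  open import Data.Empty using (⊥-elim)
  open import Data.Fin using (Fin; zero; suc)
  open import Data.Fin.Properties using (suc-injective; 0≢1+n)
  open import Data.Nat using (ℕ; suc)
  open import Function using (_∘_)
  open import Function.Definitions using (Injective)
  open import Relation.Binary.PropositionalEquality

  open import Defs using (Map)

  predOr : ∀ {m} → Fin m → Fin (suc m) → Fin m
  predOr d zero    = d
  predOr d (suc k) = k

  -- h with 0 cut out of its cycle (i ↦ h i, or h 0 if h i = 0), as a map on
  -- the remaining points 1 … m renumbered to 0 … m-1.
  splice : ∀ {m} → Map (suc m) → Map m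
  splice h i = predOr (predOr i (h zero)) (h (suc i))

  -- The matching labels of a wreath product element when copy 0 is cut out:
  -- a copy mapped to copy 0 continues through its label there.
  viaZero : ∀ {m n} → Fin (suc m) → Map n → Map n → Map n
  viaZero zero    g₀ g = g₀ ∘ g
  viaZero (suc _) g₀ g = g

  spliceLabels : ∀ {m n} → Map (suc m) → (Fin (suc m) → Map n) → Fin m → Map n
  spliceLabels h gs i = viaZero (h (suc i)) (gs zero) (gs (suc i))

  suc-splice : ∀ {m} (h : Map (suc m)) i → h (suc i) ≢ zero → h (suc i) ≡ suc (splice h i)
  suc-splice h i hi≢0 with h (suc i)
  ... | zero  = ⊥-elim (hi≢0 refl)
  ... | suc k = refl

  module _ {m : ℕ} (h : Map (suc m)) (h-inj : Injective _≡_ _≡_ h) where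

    fixed⇒suc-image : h zero ≡ zero → ∀ i → h (suc i) ≢ zero
    fixed⇒suc-image h0≡0 i e = 0≢1+n (sym (h-inj (trans e (sym h0≡0))))

    splice-zero : ∀ {a i} → h zero ≡ suc a → h (suc i) ≡ zero → splice h i ≡ a
    splice-zero {a} {i} h0≡ hi≡ rewrite hi≡ | h0≡ = refl

    splice-injective : Injective _≡_ _≡_ (splice h)
    splice-injective {i} {j} e with h (suc i) in hi | h (suc j) in hj
    ... | suc k | suc k′ = suc-injective (h-inj (trans hi (trans (cong suc e) (sym hj))))
    ... | zero  | zero   = suc-injective (h-inj (trans hi (sym hj)))
    ... | zero  | suc k′ with h zero in h0
    ...   | zero   = ⊥-elim (0≢1+n (h-inj (trans h0 (sym hi))))
    ...   | suc a′ = ⊥-elim (0≢1+n (h-inj (trans h0 (trans (cong suc e) (sym hj)))))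
    splice-injective {i} {j} e | suc k | zero with h zero in h0
    ...   | zero   = ⊥-elim (0≢1+n (h-inj (trans h0 (sym hj))))
    ...   | suc a′ = ⊥-elim (0≢1+n (h-inj (trans h0 (trans (cong suc (sym e)) (sym hi)))))

module SpliceCount where
  open import Data.Bool using (false; true)
  open import Data.Empty using (⊥-elim)
  open import Data.Fin using (Fin; zero; suc)
  open import Data.Fin.Properties using (_≟_)
  open import Data.List using (allFin)
  open import Data.Nat using (ℕ; suc; _*_)
  open import Data.Product using (_×_; _,_)
  open import Data.Vec using (Vec; _∷_; lookup)
  open import Function.Definitions using (Injective)
  open import Relation.Binary.PropositionalEquality

  open import Defs hiding (_^_)
  open Counting
  open Colourings
  open Quotients using (chromQuot-∑; chromQuot-∑-∷)
  open Splice

  edgeless : ∀ {N} → Adj N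
  edgeless _ _ = false

  module _ {m : ℕ} (h : Map (suc m)) (h-inj : Injective _≡_ _≡_ h) {y : ℕ} where

    private
      Invariant : ∀ {N} → Map N → Vec (Fin y) N → Set
      Invariant g f = ∀ v → lookup f (g v) ≡ lookup f v

      lookup-∷-image : ∀ c (t : Vec (Fin y) m) i → (h (suc i) ≡ zero → c ≡ lookup t (splice h i)) →
                       lookup (c ∷ t) (h (suc i)) ≡ lookup t (splice h i)
      lookup-∷-image c t i c≡ with h (suc i)
      ... | zero  = c≡ refl
      ... | suc k = refl

      Invariant-splice⁺ : ∀ c (t : Vec (Fin y) m) → (∀ i → h (suc i) ≡ zero → c ≡ lookup t (splice h i)) →
                          Invariant h (c ∷ t) → Invariant (splice h) t
      Invariant-splice⁺ c t c≡ inv i = trans (sym (lookup-∷-image c t i (c≡ i))) (inv (suc i))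

      Invariant-splice⁻ : ∀ c (t : Vec (Fin y) m) → (∀ i → h (suc i) ≡ zero → c ≡ lookup t (splice h i)) →
                          lookup (c ∷ t) (h zero) ≡ c → Invariant (splice h) t → Invariant h (c ∷ t)
      Invariant-splice⁻ c t c≡ inv₀ inv zero    = inv₀
      Invariant-splice⁻ c t c≡ inv₀ inv (suc i) = trans (lookup-∷-image c t i (c≡ i)) (inv i)

      no-edges : ∀ {N} (f : Vec (Fin y) N) u v → edgeless u v ≡ true → lookup f u ≢ lookup f v
      no-edges f u v ()

      PQ : ∀ {N} → Map N → Vec (Fin y) N → Set
      PQ = ProperQuotColouring edgeless

      module Fixed (h0≡0 : h zero ≡ zero) (c : Fin y) (t : Vec (Fin y) m) where

        private
          unforced : ∀ i → h (suc i) ≡ zero → c ≡ lookup t (splice h i)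
          unforced i e = ⊥-elim (fixed⇒suc-image h h-inj h0≡0 i e)

        split : PQ h (c ∷ t) → PQ (splice h) t
        split (inv , _) = Invariant-splice⁺ c t unforced inv , no-edges t

        merge : PQ (splice h) t → PQ h (c ∷ t)
        merge (inv , _) = Invariant-splice⁻ c t unforced (cong (lookup (c ∷ t)) h0≡0) inv , no-edges (c ∷ t)

      module Moved {a : Fin m} (h0≡ : h zero ≡ suc a) (c : Fin y) (t : Vec (Fin y) m) where

        private
          forced-by-a : c ≡ lookup t a → ∀ i → h (suc i) ≡ zero → c ≡ lookup t (splice h i)
          forced-by-a c≡ i hi≡0 = trans c≡ (cong (lookup t) (sym (splice-zero h h-inj h0≡ hi≡0)))

        split : PQ h (c ∷ t) → c ≡ lookup t a × PQ (splice h) t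
        split (inv , _) = c≡ , Invariant-splice⁺ c t (forced-by-a c≡) inv , no-edges t
          where c≡ = sym (trans (cong (lookup (c ∷ t)) (sym h0≡)) (inv zero))

        merge : c ≡ lookup t a → PQ (splice h) t → PQ h (c ∷ t)
        merge c≡ (inv , _) =
          Invariant-splice⁻ c t (forced-by-a c≡) (trans (cong (lookup (c ∷ t)) h0≡) (sym c≡)) inv , no-edges (c ∷ t)

    chromQuot-splice-fixed : h zero ≡ zero → chromQuot edgeless h y ≡ y * chromQuot edgeless (splice h) y
    chromQuot-splice-fixed h0≡0 = begin
      chromQuot edgeless h y
        ≡⟨ chromQuot-∑-∷ edgeless h y ⟩
      ∑ (λ c → ∑ (λ t → indicator (properQuot? edgeless h (c ∷ t))) (allVecs y m)) (allFin y)
        ≡⟨ ∑-cong (λ c → ∑-cong (λ t → indicator-cong (properQuot? edgeless h (c ∷ t)) (properQuot? edgeless (splice h) t)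
                                         (Fixed.split h0≡0 c t) (Fixed.merge h0≡0 c t))
                                 (allVecs y m)) (allFin y) ⟩
      ∑ (λ c → ∑ χ′ (allVecs y m)) (allFin y)
        ≡⟨ ∑-allFin-const {y} (∑ χ′ (allVecs y m)) ⟩
      y * ∑ χ′ (allVecs y m)
        ≡⟨ cong (y *_) (chromQuot-∑ edgeless (splice h) y) ⟨
      y * chromQuot edgeless (splice h) y ∎
      where
      open ≡-Reasoning
      χ′ : Vec (Fin y) m → ℕ
      χ′ t = indicator (properQuot? edgeless (splice h) t)

    chromQuot-splice-moved : ∀ {a} → h zero ≡ suc a → chromQuot edgeless h y ≡ chromQuot edgeless (splice h) y
    chromQuot-splice-moved {a} h0≡ = begin
      chromQuot edgeless h y
        ≡⟨ chromQuot-∑-∷ edgeless h y ⟩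
      ∑ (λ c → ∑ (λ t → indicator (properQuot? edgeless h (c ∷ t))) (allVecs y m)) (allFin y)
        ≡⟨ ∑-cong (λ c → ∑-cong (λ t → indicator-× (c ≟ lookup t a) (properQuot? edgeless (splice h) t)
                                         (properQuot? edgeless h (c ∷ t)) (Moved.split h0≡ c t) (Moved.merge h0≡ c t))
                                 (allVecs y m)) (allFin y) ⟩
      ∑ (λ c → ∑ (λ t → indicator (c ≟ lookup t a) * χ′ t) (allVecs y m)) (allFin y)
        ≡⟨ ∑-indicator-≡ _≟_ (allFin y) ∑-allFin-≟ (λ t → lookup t a) χ′ (allVecs y m) ⟩
      ∑ χ′ (allVecs y m)
        ≡⟨ chromQuot-∑ edgeless (splice h) y ⟨
      chromQuot edgeless (splice h) y ∎
      where
      open ≡-Reasoning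
      χ′ : Vec (Fin y) m → ℕ
      χ′ t = indicator (properQuot? edgeless (splice h) t)

module WreathCount where
  open import Data.Bool using (true)
  open import Data.Empty using (⊥-elim)
  open import Data.Fin using (Fin; zero; suc)
  open import Data.Nat using (ℕ; suc; _+_; _*_)
  open import Data.Product using (_×_; _,_)
  open import Data.Vec using (Vec; lookup; _++_; tabulate)
  open import Data.Vec.Properties using (tabulate∘lookup; tabulate-cong; lookup∘tabulate)
  open import Function.Definitions using (Injective)
  open import Relation.Binary.PropositionalEquality

  open import Defs hiding (_^_)
  open Counting
  open Colourings
  open Quotients using (chromQuot-∑; chromQuot-∑-++)
  open Copies
  open Splice

  Automorphism : ∀ {n} → Adj n → Map n → Set
  Automorphism adj g = ∀ u v → adj (g u) (g v) ≡ adj u v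

  module _ {n m : ℕ} (adj : Adj n) (h : Map (suc m)) (h-inj : Injective _≡_ _≡_ h)
           (gs : Fin (suc m) → Map n) {y : ℕ} where

    private
      Γ  = copiesAdj (suc m) adj
      Γ′ = copiesAdj m adj
      σ  = wrAct h gs
      σ′ = wrAct (splice h) (spliceLabels h gs)

      Proper : Vec (Fin y) n → Set
      Proper u = ∀ j j′ → adj j j′ ≡ true → lookup u j ≢ lookup u j′

      -- the colouring of copy 0 forced by copy a + 1 (block a of t)
      forced : Fin m → Vec (Fin y) (m * n) → Vec (Fin y) n
      forced a t = tabulate (λ j → block {n} {m} t a (gs zero j))

    private module _ (u : Vec (Fin y) n) (t : Vec (Fin y) (m * n)) where

      blockᶠ : Fin (suc m) → Fin n → Fin y
      blockᶠ = block {n} {suc m} (u ++ t)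

      blockᵗ : Fin m → Fin n → Fin y
      blockᵗ = block {n} {m} t

      blockᶠ-zero : ∀ j → blockᶠ zero j ≡ lookup u j
      blockᶠ-zero = block-++-zero {n} {m} u t

      blockᶠ-suc : ∀ i j → blockᶠ (suc i) j ≡ blockᵗ i j
      blockᶠ-suc = block-++-suc {n} {m} u t

      Forced : Fin m → Set
      Forced i = ∀ j → lookup u j ≡ blockᵗ (splice h i) (gs zero j)

      blockᶠ-image : ∀ i j → (h (suc i) ≡ zero → Forced i) →
                     blockᶠ (h (suc i)) (gs (suc i) j) ≡ blockᵗ (splice h i) (spliceLabels h gs i j)
      blockᶠ-image i j forced with h (suc i)
      ... | zero  = trans (blockᶠ-zero _) (forced refl (gs (suc i) j))
      ... | suc k = blockᶠ-suc k _

      BlockInvariant-splice⁺ : (∀ i → h (suc i) ≡ zero → Forced i) →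
                               BlockInvariant {n} {suc m} h gs (u ++ t) → BlockInvariant {n} {m} (splice h) (spliceLabels h gs) t
      BlockInvariant-splice⁺ forced inv i j =
        trans (sym (blockᶠ-image i j (forced i))) (trans (inv (suc i) j) (blockᶠ-suc i j))

      BlockInvariant-splice⁻ : (∀ i → h (suc i) ≡ zero → Forced i) → (∀ j → blockᶠ (h zero) (gs zero j) ≡ lookup u j) →
                               BlockInvariant {n} {m} (splice h) (spliceLabels h gs) t → BlockInvariant {n} {suc m} h gs (u ++ t)
      BlockInvariant-splice⁻ forced inv₀ inv zero    j = trans (inv₀ j) (sym (blockᶠ-zero j))
      BlockInvariant-splice⁻ forced inv₀ inv (suc i) j =
        trans (blockᶠ-image i j (forced i)) (trans (inv i j) (sym (blockᶠ-suc i j)))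

      BlockProper-++⁻ : BlockProper {n} {suc m} adj (u ++ t) → Proper u × BlockProper {n} {m} adj t
      BlockProper-++⁻ proper =
        (λ j j′ e u≡ → proper zero j j′ e (trans (blockᶠ-zero j) (trans u≡ (sym (blockᶠ-zero j′))))) ,
        (λ i j j′ e t≡ → proper (suc i) j j′ e (trans (blockᶠ-suc i j) (trans t≡ (sym (blockᶠ-suc i j′)))))

      BlockProper-++⁺ : Proper u → BlockProper {n} {m} adj t → BlockProper {n} {suc m} adj (u ++ t)
      BlockProper-++⁺ proper-u proper-t zero    j j′ e f≡ =
        proper-u j j′ e (trans (sym (blockᶠ-zero j)) (trans f≡ (blockᶠ-zero j′)))
      BlockProper-++⁺ proper-u proper-t (suc i) j j′ e f≡ =
        proper-t i j j′ e (trans (sym (blockᶠ-suc i j)) (trans f≡ (blockᶠ-suc i j′)))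

      module Fixed (h0≡0 : h zero ≡ zero) where

        private
          unforced : ∀ i → h (suc i) ≡ zero → Forced i
          unforced i e = ⊥-elim (fixed⇒suc-image h h-inj h0≡0 i e)

          blockᶠ-h0 : ∀ j → blockᶠ (h zero) j ≡ lookup u j
          blockᶠ-h0 j = trans (cong (λ k → blockᶠ k j) h0≡0) (blockᶠ-zero j)

        split : ProperQuotColouring Γ σ (u ++ t) → ProperQuotColouring adj (gs zero) u × ProperQuotColouring Γ′ σ′ t
        split pqc with ProperQuotColouring-copies⁻ {n} {suc m} adj h gs (u ++ t) pqc
        ... | inv , proper with BlockProper-++⁻ proper
        ...   | proper-u , proper-t =
          ((λ j → trans (sym (blockᶠ-h0 (gs zero j))) (trans (inv zero j) (blockᶠ-zero j))) , proper-u) ,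
          ProperQuotColouring-copies⁺ {n} {m} adj (splice h) (spliceLabels h gs) t (BlockInvariant-splice⁺ unforced inv) proper-t

        merge : ProperQuotColouring adj (gs zero) u → ProperQuotColouring Γ′ σ′ t → ProperQuotColouring Γ σ (u ++ t)
        merge (inv-u , proper-u) pqc with ProperQuotColouring-copies⁻ {n} {m} adj (splice h) (spliceLabels h gs) t pqc
        ... | inv , proper-t = ProperQuotColouring-copies⁺ {n} {suc m} adj h gs (u ++ t)
          (BlockInvariant-splice⁻ unforced (λ j → trans (blockᶠ-h0 (gs zero j)) (inv-u j)) inv)
          (BlockProper-++⁺ proper-u proper-t)

      module Moved {a : Fin m} (h0≡ : h zero ≡ suc a) where

        private
          forced-by-a : u ≡ forced a t → ∀ i → h (suc i) ≡ zero → Forced i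
          forced-by-a refl i hi≡0 j =
            trans (lookup∘tabulate _ j) (cong (λ k → blockᵗ k (gs zero j)) (sym (splice-zero h h-inj h0≡ hi≡0)))

          blockᶠ-h0 : ∀ j → blockᶠ (h zero) j ≡ blockᵗ a j
          blockᶠ-h0 j = trans (cong (λ k → blockᶠ k j) h0≡) (blockᶠ-suc a j)

        split : ProperQuotColouring Γ σ (u ++ t) → u ≡ forced a t × ProperQuotColouring Γ′ σ′ t
        split pqc with ProperQuotColouring-copies⁻ {n} {suc m} adj h gs (u ++ t) pqc
        ... | inv , proper with BlockProper-++⁻ proper
        ...   | _ , proper-t =
          u≡forced ,
          ProperQuotColouring-copies⁺ {n} {m} adj (splice h) (spliceLabels h gs) t
            (BlockInvariant-splice⁺ (forced-by-a u≡forced) inv) proper-t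
          where
          u≡forced : u ≡ forced a t
          u≡forced = trans (sym (tabulate∘lookup u)) (tabulate-cong λ j →
            trans (sym (blockᶠ-zero j)) (trans (sym (inv zero j)) (blockᶠ-h0 (gs zero j))))

        merge : Automorphism adj (gs zero) → u ≡ forced a t → ProperQuotColouring Γ′ σ′ t → ProperQuotColouring Γ σ (u ++ t)
        merge aut u≡forced pqc with ProperQuotColouring-copies⁻ {n} {m} adj (splice h) (spliceLabels h gs) t pqc
        ... | inv , proper-t = ProperQuotColouring-copies⁺ {n} {suc m} adj h gs (u ++ t)
          (BlockInvariant-splice⁻ (forced-by-a u≡forced) (λ j → trans (blockᶠ-h0 (gs zero j)) (sym (u-forced j))) inv)
          (BlockProper-++⁺ proper-u proper-t)
          where
          u-forced : ∀ j → lookup u j ≡ blockᵗ a (gs zero j)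
          u-forced j = trans (cong (λ v → lookup v j) u≡forced) (lookup∘tabulate _ j)
          proper-u : Proper u
          proper-u j j′ e u≡ = proper-t a (gs zero j) (gs zero j′) (trans (aut j j′) e)
                                 (trans (sym (u-forced j)) (trans u≡ (u-forced j′)))

    chromQuot-wreath-splice-fixed : h zero ≡ zero →
      chromQuot Γ σ y ≡ chromQuot adj (gs zero) y * chromQuot Γ′ σ′ y
    chromQuot-wreath-splice-fixed h0≡0 = begin
      chromQuot Γ σ y
        ≡⟨ chromQuot-∑-++ {n} {m * n} Γ σ y ⟩
      ∑ (λ u → ∑ (λ t → indicator (properQuot? Γ σ (u ++ t))) (allVecs y (m * n))) (allVecs y n)
        ≡⟨ ∑-cong (λ u → ∑-cong (λ t → indicator-× (properQuot? adj (gs zero) u) (properQuot? Γ′ σ′ t)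
                      (properQuot? Γ σ (u ++ t)) (Fixed.split u t h0≡0) (Fixed.merge u t h0≡0))
                    (allVecs y (m * n))) (allVecs y n) ⟩
      ∑ (λ u → ∑ (λ t → χ₀ u * χ′ t) (allVecs y (m * n))) (allVecs y n)
        ≡⟨ ∑-*-∑ χ₀ χ′ (allVecs y n) (allVecs y (m * n)) ⟨
      ∑ χ₀ (allVecs y n) * ∑ χ′ (allVecs y (m * n))
        ≡⟨ cong₂ _*_ (chromQuot-∑ adj (gs zero) y) (chromQuot-∑ Γ′ σ′ y) ⟨
      chromQuot adj (gs zero) y * chromQuot Γ′ σ′ y ∎
      where
      open ≡-Reasoning
      χ₀ : Vec (Fin y) n → ℕ
      χ₀ u = indicator (properQuot? adj (gs zero) u)
      χ′ : Vec (Fin y) (m * n) → ℕ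
      χ′ t = indicator (properQuot? Γ′ σ′ t)

    chromQuot-wreath-splice-moved : ∀ {a} → h zero ≡ suc a → Automorphism adj (gs zero) →
      chromQuot Γ σ y ≡ chromQuot Γ′ σ′ y
    chromQuot-wreath-splice-moved {a} h0≡ aut = begin
      chromQuot Γ σ y
        ≡⟨ chromQuot-∑-++ {n} {m * n} Γ σ y ⟩
      ∑ (λ u → ∑ (λ t → indicator (properQuot? Γ σ (u ++ t))) (allVecs y (m * n))) (allVecs y n)
        ≡⟨ ∑-cong (λ u → ∑-cong (λ t → indicator-× (u ≟ᵥ forced a t) (properQuot? Γ′ σ′ t)
                      (properQuot? Γ σ (u ++ t)) (Moved.split u t h0≡) (Moved.merge u t h0≡ aut))
                    (allVecs y (m * n))) (allVecs y n) ⟩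
      ∑ (λ u → ∑ (λ t → indicator (u ≟ᵥ forced a t) * χ′ t) (allVecs y (m * n))) (allVecs y n)
        ≡⟨ ∑-indicator-≡ _≟ᵥ_ (allVecs y n) (∑-allVecs-≟ y n) (forced a) χ′ (allVecs y (m * n)) ⟩
      ∑ χ′ (allVecs y (m * n))
        ≡⟨ chromQuot-∑ Γ′ σ′ y ⟨
      chromQuot Γ′ σ′ y ∎
      where
      open ≡-Reasoning
      χ′ : Vec (Fin y) (m * n) → ℕ
      χ′ t = indicator (properQuot? Γ′ σ′ t)

module CycleCount where
  open import Data.Bool.Properties using (∧-zeroʳ)
  open import Data.Bool using (false)
  open import Data.Empty using (⊥-elim)
  open import Data.Fin using (Fin; zero; suc; combine; remQuot)
  open import Data.Fin.Properties using (combine-injective; combine-remQuot)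
  open import Data.Nat using (ℕ; suc; _+_; _*_; _^_; s≤s; z≤n)
  open import Data.Nat.Properties using (<-cmp; <-irrefl; ^-monoʳ-<; ^-distribˡ-+-*)
  open import Data.Product using (proj₁; proj₂)
  open import Function.Definitions using (Injective)
  open import Relation.Binary.Definitions using (tri<; tri≈; tri>)
  open import Relation.Binary.PropositionalEquality

  open import Defs hiding (_^_)
  open Quotients using (chromQuot-edgeless)
  open Splice
  open SpliceCount
  open WreathCount

  2^-injective : Injective _≡_ _≡_ (2 ^_)
  2^-injective {a} {b} e with <-cmp a b
  ... | tri< a<b _ _ = ⊥-elim (<-irrefl e (^-monoʳ-< 2 (s≤s (s≤s z≤n)) a<b))
  ... | tri≈ _ a≡b _ = a≡b
  ... | tri> _ _ a>b = ⊥-elim (<-irrefl (sym e) (^-monoʳ-< 2 (s≤s (s≤s z≤n)) a>b))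

  wrAct-injective : ∀ {n m} (h : Map m) (gs : Fin m → Map n) →
                    Injective _≡_ _≡_ h → (∀ i → Injective _≡_ _≡_ (gs i)) → Injective _≡_ _≡_ (wrAct h gs)
  wrAct-injective {n} {m} h gs h-inj gs-inj {v} {w} e = begin
    v                       ≡⟨ combine-remQuot {m} n v ⟨
    combine (i v) (j v)     ≡⟨ cong₂ combine i≡ (gs-inj (i v) (trans (proj₂ ≡s) (cong (λ k → gs k (j w)) (sym i≡)))) ⟩
    combine (i w) (j w)     ≡⟨ combine-remQuot {m} n w ⟩
    w                       ∎
    where
    open ≡-Reasoning
    i = λ v → proj₁ (remQuot {m} n v)
    j = λ v → proj₂ (remQuot {m} n v)
    ≡s = combine-injective (h (i v)) (gs (i v) (j v)) (h (i w)) (gs (i w) (j w)) e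
    i≡ = h-inj (proj₁ ≡s)

  spliceLabels-injective : ∀ {m n} (h : Map (suc m)) (gs : Fin (suc m) → Map n) →
                           (∀ i → Injective _≡_ _≡_ (gs i)) → ∀ i → Injective _≡_ _≡_ (spliceLabels h gs i)
  spliceLabels-injective h gs gs-inj i with h (suc i)
  ... | zero  = gs-inj (suc i) ∘′ gs-inj zero
    where open import Function using (_∘′_)
  ... | suc _ = gs-inj (suc i)

  copiesAdj-edgeless : ∀ {n} m u v → copiesAdj {n} m edgeless u v ≡ false
  copiesAdj-edgeless m u v = ∧-zeroʳ _

  -- Counting 2-colourings of the edgeless graph turns the splice recurrences
  -- for chromatic polynomials into recurrences for numbers of cycles.
  module _ {m : ℕ} (h : Map (suc m)) (h-inj : Injective _≡_ _≡_ h) where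

    private
      2^cycles : ∀ {N} (g : Map N) → Injective _≡_ _≡_ g → chromQuot edgeless g 2 ≡ 2 ^ cycles g
      2^cycles g g-inj = chromQuot-edgeless edgeless (λ _ _ → refl) g g-inj 2

    cycles-splice-fixed : h zero ≡ zero → cycles h ≡ suc (cycles (splice h))
    cycles-splice-fixed h0≡0 = 2^-injective (begin
      2 ^ cycles h                        ≡⟨ 2^cycles h h-inj ⟨
      chromQuot edgeless h 2              ≡⟨ chromQuot-splice-fixed h h-inj h0≡0 ⟩
      2 * chromQuot edgeless (splice h) 2 ≡⟨ cong (2 *_) (2^cycles (splice h) (splice-injective h h-inj)) ⟩
      2 ^ suc (cycles (splice h))         ∎)
      where open ≡-Reasoning

    cycles-splice-moved : ∀ {a} → h zero ≡ suc a → cycles h ≡ cycles (splice h)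
    cycles-splice-moved h0≡ = 2^-injective (begin
      2 ^ cycles h                    ≡⟨ 2^cycles h h-inj ⟨
      chromQuot edgeless h 2          ≡⟨ chromQuot-splice-moved h h-inj h0≡ ⟩
      chromQuot edgeless (splice h) 2 ≡⟨ 2^cycles (splice h) (splice-injective h h-inj) ⟩
      2 ^ cycles (splice h)           ∎)
      where open ≡-Reasoning

    module _ {n : ℕ} (gs : Fin (suc m) → Map n) (gs-inj : ∀ i → Injective _≡_ _≡_ (gs i)) where

      private
        σ  = wrAct h gs
        σ′ = wrAct (splice h) (spliceLabels h gs)

        2^cycles-wreath : ∀ {k} (g : Map (k * n)) → Injective _≡_ _≡_ g → chromQuot (copiesAdj k edgeless) g 2 ≡ 2 ^ cycles g
        2^cycles-wreath {k} g g-inj = chromQuot-edgeless _ (copiesAdj-edgeless k) g g-inj 2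

        σ-inj  = wrAct-injective h gs h-inj gs-inj
        σ′-inj = wrAct-injective (splice h) (spliceLabels h gs) (splice-injective h h-inj) (spliceLabels-injective h gs gs-inj)

      cycles-wreath-splice-fixed : h zero ≡ zero → cycles σ ≡ cycles (gs zero) + cycles σ′
      cycles-wreath-splice-fixed h0≡0 = 2^-injective (begin
        2 ^ cycles σ
          ≡⟨ 2^cycles-wreath {suc m} σ σ-inj ⟨
        chromQuot (copiesAdj (suc m) edgeless) σ 2
          ≡⟨ chromQuot-wreath-splice-fixed edgeless h h-inj gs h0≡0 ⟩
        chromQuot edgeless (gs zero) 2 * chromQuot (copiesAdj m edgeless) σ′ 2
          ≡⟨ cong₂ _*_ (2^cycles (gs zero) (gs-inj zero)) (2^cycles-wreath {m} σ′ σ′-inj) ⟩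
        2 ^ cycles (gs zero) * 2 ^ cycles σ′
          ≡⟨ ^-distribˡ-+-* 2 (cycles (gs zero)) (cycles σ′) ⟨
        2 ^ (cycles (gs zero) + cycles σ′) ∎)
        where open ≡-Reasoning

      cycles-wreath-splice-moved : ∀ {a} → h zero ≡ suc a → cycles σ ≡ cycles σ′
      cycles-wreath-splice-moved h0≡ = 2^-injective (begin
        2 ^ cycles σ                                 ≡⟨ 2^cycles-wreath {suc m} σ σ-inj ⟨
        chromQuot (copiesAdj (suc m) edgeless) σ 2   ≡⟨ chromQuot-wreath-splice-moved edgeless h h-inj gs h0≡ (λ _ _ → refl) ⟩
        chromQuot (copiesAdj m edgeless) σ′ 2        ≡⟨ 2^cycles-wreath {m} σ′ σ′-inj ⟩
        2 ^ cycles σ′                                ∎)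
        where open ≡-Reasoning

module Inversions where
  open import Data.Empty using (⊥-elim)
  open import Data.Fin using (Fin; zero; suc; _<?_)
  open import Data.Fin.Properties using (_≟_; <-cmp; <-irrefl; suc-injective; 0≢1+n)
  open import Data.List using (allFin; map)
  open import Data.Nat using (ℕ; zero; suc; _+_; _*_)
  open import Data.Nat.Properties
    using (+-identityʳ; *-identityˡ; *-zeroʳ; *-distribʳ-+; *-distribˡ-+; +-comm; +-assoc; +-cancelʳ-≡)
  open import Data.Product using (_,_)
  open import Function using (_∘_)
  open import Function.Definitions using (Injective)
  open import Relation.Binary.Definitions using (tri<; tri≈; tri>)
  open import Relation.Binary.PropositionalEquality
  open import Relation.Nullary using (yes; no)

  open import Defs hiding (_^_; F; P)
  open Counting
  open Splice

  Lt : ∀ {M} → Fin M → Fin M → ℕ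
  Lt x y = indicator (x <? y)

  Lt-irrefl : ∀ {M} (x : Fin M) → Lt x x ≡ 0
  Lt-irrefl x = indicator-no (x <? x) (<-irrefl refl)

  Lt-+-Lt : ∀ {M} (x y : Fin M) → x ≢ y → Lt x y + Lt y x ≡ 1
  Lt-+-Lt x y x≢y with <-cmp x y
  ... | tri< x<y _ y≮x = cong₂ _+_ (indicator-yes (x <? y) x<y) (indicator-no (y <? x) y≮x)
  ... | tri≈ _ x≡y _   = ⊥-elim (x≢y x≡y)
  ... | tri> x≮y _ y<x = cong₂ _+_ (indicator-no (x <? y) x≮y) (indicator-yes (y <? x) y<x)

  #inversions : ∀ {N M} → (Fin N → Fin M) → ℕ
  #inversions {N} s = ∑ (λ i → ∑ (λ j → Lt i j * Lt (s j) (s i)) (allFin N)) (allFin N)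

  inversions≡#inversions : ∀ {N} (σ : Map N) → inversions σ ≡ #inversions σ
  inversions≡#inversions {N} σ = begin
    inversions σ
      ≡⟨ length-filter (inversion? σ) (allPairs N) ⟩
    ∑ (indicator ∘ inversion? σ) (allPairs N)
      ≡⟨ ∑-concatMap _ (λ i → map (i ,_) (allFin N)) (allFin N) ⟩
    ∑ (λ i → ∑ (indicator ∘ inversion? σ) (map (i ,_) (allFin N))) (allFin N)
      ≡⟨ ∑-cong (λ i → ∑-map _ (i ,_) (allFin N)) (allFin N) ⟩
    ∑ (λ i → ∑ (λ j → indicator (inversion? σ (i , j))) (allFin N)) (allFin N)
      ≡⟨ ∑-cong (λ i → ∑-cong (λ j → indicator-× (i <? j) (σ j <? σ i) (inversion? σ (i , j)) (λ p → p) _,_)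
                       (allFin N)) (allFin N) ⟩
    #inversions σ ∎
    where open ≡-Reasoning

  #inversions-suc : ∀ {m M} (h : Fin (suc m) → Fin M) →
                    #inversions h ≡ ∑ (λ j → Lt (h (suc j)) (h zero)) (allFin m) + #inversions (h ∘ suc)
  #inversions-suc {m} h = begin
    #inversions h
      ≡⟨ ∑-allFin-suc (λ i → ∑ (λ j → Lt i j * Lt (h j) (h i)) (allFin (suc m))) ⟩
    row zero + ∑ (row ∘ suc) (allFin m)
      ≡⟨ cong₂ _+_ (∑-allFin-suc (λ j → Lt zero j * Lt (h j) (h zero)))
                   (∑-cong (λ i → ∑-allFin-suc (λ j → Lt (suc i) j * Lt (h j) (h (suc i)))) (allFin m)) ⟩
    ∑ (λ j → 1 * Lt (h (suc j)) (h zero)) (allFin m) + #inversions (h ∘ suc)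
      ≡⟨ cong (_+ #inversions (h ∘ suc)) (∑-cong (λ j → *-identityˡ _) (allFin m)) ⟩
    ∑ (λ j → Lt (h (suc j)) (h zero)) (allFin m) + #inversions (h ∘ suc) ∎
    where
    open ≡-Reasoning
    row : Fin (suc m) → ℕ
    row i = ∑ (λ j → Lt i j * Lt (h j) (h i)) (allFin (suc m))

  #inversions-cong : ∀ {N M M′} (s : Fin N → Fin M) (t : Fin N → Fin M′) →
                     (∀ i j → Lt (s j) (s i) ≡ Lt (t j) (t i)) → #inversions s ≡ #inversions t
  #inversions-cong {N} s t e = ∑-cong (λ i → ∑-cong (λ j → cong (Lt i j *_) (e i j)) (allFin N)) (allFin N)

  ∑-update : ∀ {N} (f g : Fin N → ℕ) b → (∀ j → j ≢ b → f j ≡ g j) →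
             ∑ f (allFin N) + g b ≡ ∑ g (allFin N) + f b
  ∑-update {N} f g b f≡g = begin
    ∑ f (allFin N) + g b
      ≡⟨ cong (∑ f (allFin N) +_) (δ-sum (g b)) ⟨
    ∑ f (allFin N) + ∑ (δ (g b)) (allFin N)
      ≡⟨ ∑-distrib-+ f (δ (g b)) (allFin N) ⟨
    ∑ (λ j → f j + δ (g b) j) (allFin N)
      ≡⟨ ∑-cong pointwise (allFin N) ⟩
    ∑ (λ j → g j + δ (f b) j) (allFin N)
      ≡⟨ ∑-distrib-+ g (δ (f b)) (allFin N) ⟩
    ∑ g (allFin N) + ∑ (δ (f b)) (allFin N)
      ≡⟨ cong (∑ g (allFin N) +_) (δ-sum (f b)) ⟩
    ∑ g (allFin N) + f b ∎
    where
    open ≡-Reasoning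
    δ : ℕ → Fin N → ℕ
    δ c j = indicator (j ≟ b) * c
    δ-sum : ∀ c → ∑ (δ c) (allFin N) ≡ c
    δ-sum c = trans (sym (*-distribʳ-∑ c _ (allFin N))) (trans (cong (_* c) (∑-allFin-≟ b)) (+-identityʳ c))
    pointwise : ∀ j → f j + δ (g b) j ≡ g j + δ (f b) j
    pointwise j with j ≟ b
    ... | yes refl = trans (cong (f j +_) (+-identityʳ _)) (trans (+-comm (f j) (g j)) (cong (g j +_) (sym (+-identityʳ _))))
    ... | no j≢b   = cong (_+ 0) (f≡g j j≢b)

  module _ {m : ℕ} (h : Map (suc m)) (h-inj : Injective _≡_ _≡_ h) where

    inversions-splice-fixed : h zero ≡ zero → inversions h ≡ inversions (splice h)
    inversions-splice-fixed h0≡0 = begin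
      inversions h
        ≡⟨ inversions≡#inversions h ⟩
      #inversions h
        ≡⟨ #inversions-suc h ⟩
      ∑ (λ j → Lt (h (suc j)) (h zero)) (allFin m) + #inversions (h ∘ suc)
        ≡⟨ cong₂ _+_ (trans (∑-cong (λ j → cong (Lt (h (suc j))) h0≡0) (allFin m)) (∑-zero (allFin m)))
                     (#inversions-cong (h ∘ suc) (splice h) λ i j → cong₂ Lt (h-suc j) (h-suc i)) ⟩
      #inversions (splice h)
        ≡⟨ inversions≡#inversions (splice h) ⟨
      inversions (splice h) ∎
      where
      open ≡-Reasoning
      h-suc : ∀ i → h (suc i) ≡ suc (splice h i)
      h-suc i = suc-splice h i (fixed⇒suc-image h h-inj h0≡0 i)

    -- With h 0 = a + 1 and h (b + 1) = 0, the map s = h ∘ suc differs from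
    -- t = suc ∘ splice h only at b, where the value 0 is replaced by a + 1.
    module Moved {a b : Fin m} (h0≡ : h zero ≡ suc a) (hb≡ : h (suc b) ≡ zero) where

      private
        s t : Fin m → Fin (suc m)
        s = h ∘ suc
        t = suc ∘ splice h

        s≢0 : ∀ j → j ≢ b → s j ≢ zero
        s≢0 j j≢b e = j≢b (suc-injective (h-inj (trans e (sym hb≡))))

        s≢a : ∀ j → s j ≢ suc a
        s≢a j e = 0≢1+n (sym (h-inj (trans e (sym h0≡))))

        t≡s : ∀ j → j ≢ b → t j ≡ s j
        t≡s j j≢b = sym (suc-splice h j (s≢0 j j≢b))

        t-b : t b ≡ suc a
        t-b = cong suc (splice-zero h h-inj h0≡ hb≡)

      before after : ℕ
      before = ∑ (λ j → Lt j b * Lt (s j) (suc a)) (allFin m)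
      after  = ∑ (λ j → Lt b j * Lt (s j) (suc a)) (allFin m)

      private
        below-a : ∑ (λ j → Lt (s j) (suc a)) (allFin m) ≡ before + 1 + after
        below-a = begin
          ∑ (λ j → Lt (s j) (suc a)) (allFin m)
            ≡⟨ ∑-cong split (allFin m) ⟩
          ∑ (λ j → Lt j b * Lt (s j) (suc a) + indicator (j ≟ b) + Lt b j * Lt (s j) (suc a)) (allFin m)
            ≡⟨ ∑-distrib-+ _ _ (allFin m) ⟩
          ∑ (λ j → Lt j b * Lt (s j) (suc a) + indicator (j ≟ b)) (allFin m) + after
            ≡⟨ cong (_+ after) (trans (∑-distrib-+ _ _ (allFin m)) (cong (before +_) (∑-allFin-≟ b))) ⟩
          before + 1 + after ∎
          where
          open ≡-Reasoning
          split : ∀ j → Lt (s j) (suc a) ≡ Lt j b * Lt (s j) (suc a) + indicator (j ≟ b) + Lt b j * Lt (s j) (suc a)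
          split j with j ≟ b
          ... | yes refl rewrite Lt-irrefl b | hb≡ = refl
          ... | no j≢b   = begin
            Lt (s j) (suc a)                                 ≡⟨ *-identityˡ _ ⟨
            1 * Lt (s j) (suc a)                             ≡⟨ cong (_* Lt (s j) (suc a)) (Lt-+-Lt j b j≢b) ⟨
            (Lt j b + Lt b j) * Lt (s j) (suc a)             ≡⟨ *-distribʳ-+ (Lt (s j) (suc a)) (Lt j b) (Lt b j) ⟩
            Lt j b * Lt (s j) (suc a) + Lt b j * Lt (s j) (suc a)
              ≡⟨ cong (_+ Lt b j * Lt (s j) (suc a)) (+-identityʳ _) ⟨
            Lt j b * Lt (s j) (suc a) + 0 + Lt b j * Lt (s j) (suc a) ∎

        rowˢ rowᵗ : Fin m → ℕ
        rowˢ i = ∑ (λ j → Lt i j * Lt (s j) (s i)) (allFin m)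
        rowᵗ i = ∑ (λ j → Lt i j * Lt (t j) (t i)) (allFin m)

        colˢ colᵗ : ℕ
        colˢ = ∑ (λ i → Lt i b * Lt (s b) (s i)) (allFin m)
        colᵗ = ∑ (λ i → Lt i b * Lt (t b) (t i)) (allFin m)

        rowᵗ-b : rowᵗ b ≡ after
        rowᵗ-b = ∑-cong pointwise (allFin m)
          where
          pointwise : ∀ j → Lt b j * Lt (t j) (t b) ≡ Lt b j * Lt (s j) (suc a)
          pointwise j with j ≟ b
          ... | yes refl rewrite Lt-irrefl b = refl
          ... | no j≢b   = cong (Lt b j *_) (cong₂ Lt (t≡s j j≢b) t-b)

        rowˢ-b : rowˢ b ≡ 0
        rowˢ-b = trans (∑-cong (λ j → trans (cong (λ x → Lt b j * Lt (s j) x) hb≡) (*-zeroʳ (Lt b j))) (allFin m))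
                       (∑-zero (allFin m))

        colˢ≡ : colˢ ≡ before + colᵗ
        colˢ≡ = trans (∑-cong pointwise (allFin m)) (∑-distrib-+ _ _ (allFin m))
          where
          open ≡-Reasoning
          Lt-sb : ∀ x → x ≢ zero → Lt (s b) x ≡ 1
          Lt-sb zero    x≢0 = ⊥-elim (x≢0 refl)
          Lt-sb (suc k) x≢0 rewrite hb≡ = refl
          pointwise : ∀ i → Lt i b * Lt (s b) (s i) ≡ Lt i b * Lt (s i) (suc a) + Lt i b * Lt (t b) (t i)
          pointwise i with i ≟ b
          ... | yes refl rewrite Lt-irrefl b = refl
          ... | no i≢b   = begin
            Lt i b * Lt (s b) (s i)                              ≡⟨ cong (Lt i b *_) (Lt-sb (s i) (s≢0 i i≢b)) ⟩
            Lt i b * 1                                           ≡⟨ cong (Lt i b *_) (Lt-+-Lt (s i) (suc a) (s≢a i)) ⟨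
            Lt i b * (Lt (s i) (suc a) + Lt (suc a) (s i))       ≡⟨ *-distribˡ-+ (Lt i b) _ _ ⟩
            Lt i b * Lt (s i) (suc a) + Lt i b * Lt (suc a) (s i)
              ≡⟨ cong (λ x → Lt i b * Lt (s i) (suc a) + Lt i b * x) (cong₂ Lt t-b (t≡s i i≢b)) ⟨
            Lt i b * Lt (s i) (suc a) + Lt i b * Lt (t b) (t i) ∎

        rows : ∑ rowˢ (allFin m) + colᵗ + rowᵗ b ≡ ∑ rowᵗ (allFin m) + colˢ + rowˢ b
        rows = begin
          ∑ rowˢ (allFin m) + colᵗ + rowᵗ b
            ≡⟨ cong (_+ rowᵗ b) (∑-distrib-+ rowˢ _ (allFin m)) ⟨
          ∑ (λ i → rowˢ i + Lt i b * Lt (t b) (t i)) (allFin m) + rowᵗ b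
            ≡⟨ cong (Σˢ +_) (+-identityʳ (rowᵗ b)) ⟨
          ∑ (λ i → rowˢ i + Lt i b * Lt (t b) (t i)) (allFin m) + (rowᵗ b + 0)
            ≡⟨ cong (λ x → Σˢ + (rowᵗ b + x * Lt (s b) (s b))) (Lt-irrefl b) ⟨
          ∑ (λ i → rowˢ i + Lt i b * Lt (t b) (t i)) (allFin m) + (rowᵗ b + Lt b b * Lt (s b) (s b))
            ≡⟨ ∑-update (λ i → rowˢ i + Lt i b * Lt (t b) (t i)) (λ i → rowᵗ i + Lt i b * Lt (s b) (s i)) b
                        (λ i i≢b → ∑-update (λ j → Lt i j * Lt (s j) (s i)) (λ j → Lt i j * Lt (t j) (t i)) b
                                     (λ j j≢b → cong (Lt i j *_) (cong₂ Lt (sym (t≡s j j≢b)) (sym (t≡s i i≢b))))) ⟩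
          ∑ (λ i → rowᵗ i + Lt i b * Lt (s b) (s i)) (allFin m) + (rowˢ b + Lt b b * Lt (t b) (t b))
            ≡⟨ cong₂ _+_ (∑-distrib-+ rowᵗ _ (allFin m)) (cong (λ x → rowˢ b + x * Lt (t b) (t b)) (Lt-irrefl b)) ⟩
          ∑ rowᵗ (allFin m) + colˢ + (rowˢ b + 0)
            ≡⟨ cong (∑ rowᵗ (allFin m) + colˢ +_) (+-identityʳ (rowˢ b)) ⟩
          ∑ rowᵗ (allFin m) + colˢ + rowˢ b ∎
          where
          open ≡-Reasoning
          Σˢ = ∑ (λ i → rowˢ i + Lt i b * Lt (t b) (t i)) (allFin m)

      inversions-splice-moved : inversions h ≡ suc (inversions (splice h) + before + before)
      inversions-splice-moved = begin
        inversions h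
          ≡⟨ inversions≡#inversions h ⟩
        #inversions h
          ≡⟨ #inversions-suc h ⟩
        ∑ (λ j → Lt (s j) (h zero)) (allFin m) + #inversions s
          ≡⟨ cong (λ x → ∑ (λ j → Lt (s j) x) (allFin m) + #inversions s) h0≡ ⟩
        ∑ (λ j → Lt (s j) (suc a)) (allFin m) + #inversions s
          ≡⟨ cong (_+ #inversions s) below-a ⟩
        before + 1 + after + #inversions s
          ≡⟨ rearrange before after (#inversions s) ⟩
        suc (before + (#inversions s + after))
          ≡⟨ cong (λ x → suc (before + x)) exchange ⟩
        suc (before + (#inversions t + before))
          ≡⟨ cong suc (+-comm before _) ⟩
        suc (#inversions t + before + before)
          ≡⟨ cong (λ x → suc (x + before + before)) (inversions≡#inversions (splice h)) ⟨
        suc (inversions (splice h) + before + before) ∎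
        where
        open ≡-Reasoning
        rearrange : ∀ l r p → l + 1 + r + p ≡ suc (l + (p + r))
        rearrange = solve 3 (λ l r p → l :+ con 1 :+ r :+ p := con 1 :+ (l :+ (p :+ r))) refl
          where open import Data.Nat.Solver using (module +-*-Solver)
                open +-*-Solver
        exchange : #inversions s + after ≡ #inversions t + before
        exchange = +-cancelʳ-≡ colᵗ _ _ (begin
          #inversions s + after + colᵗ       ≡⟨ +-assoc (#inversions s) after colᵗ ⟩
          #inversions s + (after + colᵗ)     ≡⟨ cong (#inversions s +_) (+-comm after colᵗ) ⟩
          #inversions s + (colᵗ + after)     ≡⟨ +-assoc (#inversions s) colᵗ after ⟨
          #inversions s + colᵗ + after       ≡⟨ cong (#inversions s + colᵗ +_) rowᵗ-b ⟨
          #inversions s + colᵗ + rowᵗ b      ≡⟨ rows ⟩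
          #inversions t + colˢ + rowˢ b      ≡⟨ cong₂ (λ x y → #inversions t + x + y) colˢ≡ rowˢ-b ⟩
          #inversions t + (before + colᵗ) + 0 ≡⟨ +-identityʳ _ ⟩
          #inversions t + (before + colᵗ)    ≡⟨ +-assoc (#inversions t) before colᵗ ⟨
          #inversions t + before + colᵗ      ∎)

module Sign where
  open import Data.Empty using (⊥-elim)
  open import Data.Fin using (Fin; zero; suc)
  open import Data.Fin.Properties using (0≢1+n)
  open import Data.Nat using (zero; suc; _+_)
  open import Data.Product using (∃; _,_)
  open import Function.Definitions using (Injective)
  open import Relation.Binary.PropositionalEquality

  open import Defs using (Map; cycles; inversions)
  open Splice
  open CycleCount using (cycles-splice-fixed; cycles-splice-moved)
  open Inversions

  Onto : ∀ {N} → Map N → Set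
  Onto {N} h = ∀ (k : Fin N) → ∃ λ i → h i ≡ k

  splice-onto : ∀ {m} (h : Map (suc m)) → Onto h → Onto (splice h)
  splice-onto h onto k with onto (suc k)
  ... | suc i , hi≡ = i , cong (predOr (predOr i (h zero))) hi≡
  ... | zero  , h0≡ with onto zero
  ...   | zero  , h0≡0 = ⊥-elim (0≢1+n (trans (sym h0≡0) h0≡))
  ...   | suc i , hi≡0 = i , trans (cong (predOr (predOr i (h zero))) hi≡0) (cong (predOr i) h0≡)

  cycles+inversions : ∀ m (h : Map m) → Injective _≡_ _≡_ h → Onto h →
                      ∃ λ k → cycles h + inversions h ≡ m + (k + k)
  cycles+inversions zero    h h-inj onto = 0 , refl
  cycles+inversions (suc m) h h-inj onto with h zero in h0≡
  ... | zero with cycles+inversions m (splice h) (splice-injective h h-inj) (splice-onto h onto)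
  ...   | k , eq = k , (begin
    cycles h + inversions h                         ≡⟨ cong₂ _+_ (cycles-splice-fixed h h-inj h0≡) (inversions-splice-fixed h h-inj h0≡) ⟩
    suc (cycles (splice h) + inversions (splice h)) ≡⟨ cong suc eq ⟩
    suc (m + (k + k))                               ∎)
    where open ≡-Reasoning
  cycles+inversions (suc m) h h-inj onto | suc a with onto zero
  ... | zero  , h0≡0 = ⊥-elim (0≢1+n (trans (sym h0≡0) h0≡))
  ... | suc b , hb≡0 with cycles+inversions m (splice h) (splice-injective h h-inj) (splice-onto h onto)
  ...   | k , eq = k + l , (begin
    cycles h + inversions h
      ≡⟨ cong₂ _+_ (cycles-splice-moved h h-inj h0≡) (Moved.inversions-splice-moved h h-inj h0≡ hb≡0) ⟩
    cycles (splice h) + suc (inversions (splice h) + l + l)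
      ≡⟨ rearrange (cycles (splice h)) (inversions (splice h)) l ⟩
    suc (cycles (splice h) + inversions (splice h) + (l + l))
      ≡⟨ cong (λ x → suc (x + (l + l))) eq ⟩
    suc (m + (k + k) + (l + l))
      ≡⟨ cong suc (regroup m k l) ⟩
    suc (m + ((k + l) + (k + l))) ∎)
    where
    open ≡-Reasoning
    open import Data.Nat.Solver using (module +-*-Solver)
    open +-*-Solver
    l = Moved.before h h-inj h0≡ hb≡0
    rearrange : ∀ c i l → c + suc (i + l + l) ≡ suc (c + i + (l + l))
    rearrange = solve 3 (λ c i l → c :+ (con 1 :+ (i :+ l :+ l)) := con 1 :+ (c :+ i :+ (l :+ l))) refl
    regroup : ∀ m k l → m + (k + k) + (l + l) ≡ m + ((k + l) + (k + l))
    regroup = solve 3 (λ m k l → m :+ (k :+ k) :+ (l :+ l) := m :+ ((k :+ l) :+ (k :+ l))) refl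

module Rationals where
  open import Algebra.Bundles using (CommutativeRing)
  open import Data.Integer as ℤ using (+_)
  import Data.Integer.Solver
  open import Data.List using (List; []; _∷_; length; map)
  open import Data.Nat as ℕ using (ℕ; zero; suc)
  import Data.Nat.Properties as ℕ
  open import Data.Rational using (1ℚ; _+_; _*_; _/_; toℚᵘ)
  open import Data.Rational.Properties
  import Data.Rational.Unnormalised as ℚᵘ
  import Data.Rational.Unnormalised.Properties as ℚᵘ
  open import Data.Rational.Solver using (module +-*-Solver)
  open import Function using (_∘_)
  open import Relation.Binary.PropositionalEquality

  open import Defs using (fromℕ; _^_; sumℕ)
  open ListSum (CommutativeRing.commutativeSemiring +-*-commutativeRing) public

  private
    module ℤ-Solver = Data.Integer.Solver.+-*-Solver

    fromℕ/suc≃ : ∀ (a : ℕ) d → toℚᵘ (+ a / suc d) ℚᵘ.≃ ℚᵘ.mkℚᵘ (+ a) d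
    fromℕ/suc≃ a d = toℚᵘ-fromℚᵘ (ℚᵘ.mkℚᵘ (+ a) d)

  fromℕ-suc : ∀ k → fromℕ (suc k) ≡ 1ℚ + fromℕ k
  fromℕ-suc k = toℚᵘ-injective (ℚᵘ.≃-trans (fromℕ/suc≃ (suc k) 0) (ℚᵘ.≃-sym (ℚᵘ.≃-trans (toℚᵘ-homo-+ 1ℚ (fromℕ k))
                  (ℚᵘ.≃-trans (ℚᵘ.+-cong {toℚᵘ 1ℚ} {ℚᵘ.mkℚᵘ (+ 1) 0} ℚᵘ.≃-refl (fromℕ/suc≃ k 0)) (ℚᵘ.*≡* (cross k))))))
    where
    open ℤ-Solver
    cross : ∀ k → (+ 1 ℤ.* + 1 ℤ.+ + k ℤ.* + 1) ℤ.* + 1 ≡ + suc k ℤ.* + (1 ℕ.* 1)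
    cross k = solve 1 (λ K → (con (+ 1) :* con (+ 1) :+ K :* con (+ 1)) :* con (+ 1) := (con (+ 1) :+ K) :* con (+ 1)) refl (+ k)

  fromℕ-+ : ∀ a b → fromℕ (a ℕ.+ b) ≡ fromℕ a + fromℕ b
  fromℕ-+ zero    b = sym (+-identityˡ (fromℕ b))
  fromℕ-+ (suc a) b = begin
    fromℕ (suc (a ℕ.+ b))        ≡⟨ fromℕ-suc (a ℕ.+ b) ⟩
    1ℚ + fromℕ (a ℕ.+ b)         ≡⟨ cong (λ x → 1ℚ + x) (fromℕ-+ a b) ⟩
    1ℚ + (fromℕ a + fromℕ b)     ≡⟨ +-assoc 1ℚ (fromℕ a) (fromℕ b) ⟨
    1ℚ + fromℕ a + fromℕ b       ≡⟨ cong (_+ fromℕ b) (fromℕ-suc a) ⟨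
    fromℕ (suc a) + fromℕ b      ∎
    where open ≡-Reasoning

  fromℕ-* : ∀ a b → fromℕ (a ℕ.* b) ≡ fromℕ a * fromℕ b
  fromℕ-* zero    b = sym (*-zeroˡ (fromℕ b))
  fromℕ-* (suc a) b = begin
    fromℕ (b ℕ.+ a ℕ.* b)             ≡⟨ fromℕ-+ b (a ℕ.* b) ⟩
    fromℕ b + fromℕ (a ℕ.* b)         ≡⟨ cong (λ x → fromℕ b + x) (fromℕ-* a b) ⟩
    fromℕ b + fromℕ a * fromℕ b       ≡⟨ cong (_+ fromℕ a * fromℕ b) (*-identityˡ (fromℕ b)) ⟨
    1ℚ * fromℕ b + fromℕ a * fromℕ b  ≡⟨ *-distribʳ-+ (fromℕ b) 1ℚ (fromℕ a) ⟨
    (1ℚ + fromℕ a) * fromℕ b          ≡⟨ cong (_* fromℕ b) (fromℕ-suc a) ⟨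
    fromℕ (suc a) * fromℕ b           ∎
    where open ≡-Reasoning

  fromℕ-*-/ : ∀ d .{{_ : ℕ.NonZero d}} k → fromℕ d * (+ k / d) ≡ fromℕ k
  fromℕ-*-/ (suc d) k = toℚᵘ-injective (ℚᵘ.≃-trans (toℚᵘ-homo-* (fromℕ (suc d)) (+ k / suc d))
    (ℚᵘ.≃-trans (ℚᵘ.*-cong {toℚᵘ (fromℕ (suc d))} {ℚᵘ.mkℚᵘ (+ suc d) 0} (fromℕ/suc≃ (suc d) 0) (fromℕ/suc≃ k d))
      (ℚᵘ.≃-trans (ℚᵘ.*≡* (cross d k)) (ℚᵘ.≃-sym (fromℕ/suc≃ k 0)))))
    where
    open ℤ-Solver
    cross : ∀ d k → (+ suc d ℤ.* + k) ℤ.* + 1 ≡ + k ℤ.* + (1 ℕ.* suc d)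
    cross d k = trans (solve 2 (λ D K → (D :* K) :* con (+ 1) := K :* D) refl (+ suc d) (+ k))
                      (cong (λ z → + k ℤ.* + z) (sym (ℕ.*-identityˡ (suc d))))

  fromℕ-sumℕ : ∀ {A : Set} (f : A → ℕ) xs → fromℕ (sumℕ (map f xs)) ≡ ∑ (fromℕ ∘ f) xs
  fromℕ-sumℕ f []       = refl
  fromℕ-sumℕ f (x ∷ xs) = trans (fromℕ-+ (f x) _) (cong (λ y → fromℕ (f x) + y) (fromℕ-sumℕ f xs))

  ∑-const : ∀ {A : Set} c (xs : List A) → ∑ (λ _ → c) xs ≡ fromℕ (length xs) * c
  ∑-const c []       = sym (*-zeroˡ c)
  ∑-const c (x ∷ xs) = begin
    c + ∑ (λ _ → c) xs                 ≡⟨ cong (λ x → c + x) (∑-const c xs) ⟩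
    c + fromℕ (length xs) * c          ≡⟨ cong (_+ fromℕ (length xs) * c) (*-identityˡ c) ⟨
    1ℚ * c + fromℕ (length xs) * c     ≡⟨ *-distribʳ-+ c 1ℚ (fromℕ (length xs)) ⟨
    (1ℚ + fromℕ (length xs)) * c       ≡⟨ cong (_* c) (fromℕ-suc (length xs)) ⟨
    fromℕ (suc (length xs)) * c        ∎
    where open ≡-Reasoning

  ^-distribˡ-+-* : ∀ q a b → q ^ (a ℕ.+ b) ≡ q ^ a * q ^ b
  ^-distribˡ-+-* q zero    b = sym (*-identityˡ _)
  ^-distribˡ-+-* q (suc a) b = trans (cong (q *_) (^-distribˡ-+-* q a b)) (sym (*-assoc q (q ^ a) (q ^ b)))

  ^-distribʳ-* : ∀ p q k → (p * q) ^ k ≡ p ^ k * q ^ k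
  ^-distribʳ-* p q zero    = refl
  ^-distribʳ-* p q (suc k) = trans (cong ((p * q) *_) (^-distribʳ-* p q k)) (interchange p q (p ^ k) (q ^ k))
    where
    open +-*-Solver
    interchange : ∀ a b c d → (a * b) * (c * d) ≡ (a * c) * (b * d)
    interchange = solve 4 (λ a b c d → (a :* b) :* (c :* d) := (a :* c) :* (b :* d)) refl

  ^-*-assoc : ∀ q a b → (q ^ a) ^ b ≡ q ^ (a ℕ.* b)
  ^-*-assoc q a zero    = cong (q ^_) (sym (ℕ.*-zeroʳ a))
  ^-*-assoc q a (suc b) = trans (cong (q ^ a *_) (^-*-assoc q a b))
                                (trans (sym (^-distribˡ-+-* q a (a ℕ.* b))) (cong (q ^_) (sym (ℕ.*-suc a b))))

  ^-zeroˡ : ∀ k → 1ℚ ^ k ≡ 1ℚ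
  ^-zeroˡ zero    = refl
  ^-zeroˡ (suc k) = trans (*-identityˡ _) (^-zeroˡ k)

module WreathSum where
  open import Data.Fin using (Fin; zero; suc)
  open import Data.List using (List; []; _∷_; map)
  open import Data.List.Properties using (length-map)
  open import Data.List.Relation.Unary.All as All using (All; []; _∷_)
  import Data.List.Relation.Unary.All.Properties as All
  import Data.List.Relation.Unary.Any as Any
  open import Data.List.Relation.Unary.AllPairs using ([]; _∷_)
  open import Data.Fin.Properties using (_≟_; all?)
  open import Data.Nat as ℕ using (ℕ; zero; suc)
  open import Data.Nat.Properties using (≤-reflexive)
  open import Data.Product using (_×_; _,_)
  open import Data.Rational using (ℚ; 1ℚ; _+_; _*_)
  open import Data.Rational.Properties using (*-assoc)
  open import Data.Rational.Solver using (module +-*-Solver)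
  open import Function using (_∘_)
  open import Function.Definitions using (Injective)
  open import Relation.Binary.PropositionalEquality hiding (_≗_)
  open import Relation.Nullary using (Dec)

  open import Defs
  open Rationals
  open Splice
  open Copies using (wrAct-cong)
  open CycleCount using (cycles-splice-fixed; cycles-splice-moved)

  private variable
    A : Set

  ≗-sym : ∀ {n} {σ τ : Map n} → σ ≗ τ → τ ≗ σ
  ≗-sym e i = sym (e i)

  ≗-trans : ∀ {n} {σ τ ρ : Map n} → σ ≗ τ → τ ≗ ρ → σ ≗ ρ
  ≗-trans e f i = trans (e i) (f i)

  _≗?_ : ∀ {n} (σ τ : Map n) → Dec (σ ≗ τ)
  σ ≗? τ = all? (λ i → σ i ≟ τ i)

  ∑-tuples-suc : ∀ (xs : List A) m (V : (Fin (suc m) → A) → ℚ) →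
                 ∑ V (tuples xs (suc m)) ≡ ∑ (λ a → ∑ (λ gs → V (cons a gs)) (tuples xs m)) xs
  ∑-tuples-suc xs m V = trans (∑-concatMap V (λ a → map (cons a) (tuples xs m)) xs)
                              (∑-cong (λ a → ∑-map V (cons a) (tuples xs m)) xs)

  All-tuples : ∀ {P : A → Set} {xs} → All P xs → ∀ m → All (λ gs → ∀ i → P (gs i)) (tuples xs m)
  All-tuples ps zero    = (λ ()) ∷ []
  All-tuples ps (suc m) = All.concat⁺ (All.map⁺ (All.map (λ pa → All.map⁺ (All.map (λ pgs →
    λ { zero → pa ; (suc i) → pgs i }) (All-tuples ps m))) ps))

  module _ {n : ℕ} (G : PermGroup n) where

    open Reindex (≗-sym {n}) ≗-trans _≗?_

    private
      RespectsG : (Map n → ℚ) → Set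
      RespectsG U = ∀ {a b} → a ≗ b → U a ≡ U b

    ∈-elems : All (_∈ₑ elems G) (elems G)
    ∈-elems = All.tabulate (Any.map (λ { refl _ → refl }))

    PreservesSum : (Map n → Map n) → Set
    PreservesSum τ = ∀ U → RespectsG U → ∑ (U ∘ τ) (elems G) ≡ ∑ U (elems G)

    left-translation-preservesSum : ∀ g₀ → g₀ ∈ₑ elems G → Injective _≡_ _≡_ g₀ → PreservesSum (g₀ ∘_)
    left-translation-preservesSum g₀ g₀∈G g₀-inj U U-resp = begin
      ∑ (U ∘ (g₀ ∘_)) (elems G)        ≡⟨ ∑-map U (g₀ ∘_) (elems G) ⟨
      ∑ U (map (g₀ ∘_) (elems G))      ≡⟨ ∑-reindex U U-resp (elems G) (map (g₀ ∘_) (elems G)) (distinct-map (distinct G))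
                                            (All.map⁺ (All.map (closed G g₀ _ g₀∈G) ∈-elems))
                                            (≤-reflexive (sym (length-map (g₀ ∘_) (elems G)))) ⟩
      ∑ U (elems G)                    ∎
      where
      open ≡-Reasoning
      distinct-map : ∀ {xs} → Distinct xs → Distinct (map (g₀ ∘_) xs)
      distinct-map []       = []
      distinct-map (a ∷ d) = All.map⁺ (All.map (λ a≁b e → a≁b (λ i → g₀-inj (e i))) a) ∷ distinct-map d

    ∑-tuples-preserved : ∀ m (τ : Fin m → Map n → Map n) → (∀ i → PreservesSum (τ i)) →
                         (V : (Fin m → Map n) → ℚ) → (∀ gs gs′ → (∀ i → gs i ≗ gs′ i) → V gs ≡ V gs′) →
                         ∑ (λ gs → V (λ i → τ i (gs i))) (tuples (elems G) m) ≡ ∑ V (tuples (elems G) m)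
    ∑-tuples-preserved zero    τ τ-pres V V-resp = cong (λ x → x + _) (V-resp _ _ (λ ()))
    ∑-tuples-preserved (suc m) τ τ-pres V V-resp = begin
      ∑ (λ gs → V (λ i → τ i (gs i))) (tuples (elems G) (suc m))
        ≡⟨ ∑-tuples-suc (elems G) m _ ⟩
      ∑ (λ a → ∑ (λ gs → V (λ i → τ i (cons a gs i))) (tuples (elems G) m)) (elems G)
        ≡⟨ ∑-cong (λ a → ∑-cong (λ gs → V-resp _ _ λ { zero _ → refl ; (suc i) _ → refl }) (tuples (elems G) m)) (elems G) ⟩
      ∑ (λ a → ∑ (λ gs → V (cons (τ zero a) (λ i → τ (suc i) (gs i)))) (tuples (elems G) m)) (elems G)
        ≡⟨ ∑-cong (λ a → ∑-tuples-preserved m (τ ∘ suc) (τ-pres ∘ suc) (V ∘ cons (τ zero a))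
                           (λ gs gs′ e → V-resp _ _ λ { zero _ → refl ; (suc i) → e i })) (elems G) ⟩
      ∑ (U ∘ τ zero) (elems G)
        ≡⟨ τ-pres zero U (λ e → ∑-cong (λ gs → V-resp _ _ λ { zero → e ; (suc i) _ → refl }) (tuples (elems G) m)) ⟩
      ∑ U (elems G)
        ≡⟨ ∑-tuples-suc (elems G) m V ⟨
      ∑ V (tuples (elems G) (suc m)) ∎
      where
      open ≡-Reasoning
      U : Map n → ℚ
      U b = ∑ (λ gs → V (cons b gs)) (tuples (elems G) m)

    viaZero-preservesSum : ∀ {m} (c : Fin (suc m)) g₀ → g₀ ∈ₑ elems G → Injective _≡_ _≡_ g₀ → PreservesSum (viaZero c g₀)
    viaZero-preservesSum zero    g₀ g₀∈G g₀-inj = left-translation-preservesSum g₀ g₀∈G g₀-inj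
    viaZero-preservesSum (suc _) g₀ g₀∈G g₀-inj U U-resp = refl

    -- Weights that factor along splice, such as σ ↦ P_{Γ/σ}(x) and σ ↦ z^{c(σ)}.
    module Multiplicative
      (Admissible : Map n → Set) (admissible : All Admissible (elems G))
      (admissible⇒injective : ∀ {g} → Admissible g → Injective _≡_ _≡_ g)
      (ω : Map n → ℚ) (Ω : ∀ m → Map (m ℕ.* n) → ℚ)
      (Ω-empty : ∀ σ → Ω 0 σ ≡ 1ℚ)
      (Ω-cong : ∀ m {σ τ} → σ ≗ τ → Ω m σ ≡ Ω m τ)
      (Ω-fixed : ∀ m (h : Map (suc m)) gs → Injective _≡_ _≡_ h → (∀ i → Admissible (gs i)) → h zero ≡ zero →
                 Ω (suc m) (wrAct h gs) ≡ ω (gs zero) * Ω m (wrAct (splice h) (spliceLabels h gs)))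
      (Ω-moved : ∀ m (h : Map (suc m)) gs → Injective _≡_ _≡_ h → (∀ i → Admissible (gs i)) → ∀ {a} → h zero ≡ suc a →
                 Ω (suc m) (wrAct h gs) ≡ Ω m (wrAct (splice h) (spliceLabels h gs)))
      (q : ℚ) (|G|*q≡∑ω : fromℕ (order G) * q ≡ ∑ ω (elems G))
      where

      private
        |G| = fromℕ (order G)

        admissible-∈ : All (λ g → g ∈ₑ elems G × Admissible g) (elems G)
        admissible-∈ = All.zipWith (λ p → p) (∈-elems , admissible)

        ∑-spliceLabels : ∀ m (h : Map (suc m)) {g₀} → g₀ ∈ₑ elems G → Admissible g₀ →
          ∑ (λ gs → Ω m (wrAct (splice h) (spliceLabels h (cons g₀ gs)))) (tuples (elems G) m) ≡
          ∑ (λ gs → Ω m (wrAct (splice h) gs)) (tuples (elems G) m)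
        ∑-spliceLabels m h {g₀} g₀∈G g₀-adm =
          ∑-tuples-preserved m (λ i → viaZero (h (suc i)) g₀)
            (λ i → viaZero-preservesSum (h (suc i)) g₀ g₀∈G (admissible⇒injective g₀-adm))
            (λ gs → Ω m (wrAct (splice h) gs)) (λ gs gs′ e → Ω-cong m (wrAct-cong (splice h) gs gs′ e))

      ∑-wreath : ∀ m (h : Map m) → Injective _≡_ _≡_ h →
                 ∑ (λ gs → Ω m (wrAct h gs)) (tuples (elems G) m) ≡ |G| ^ m * q ^ cycles h
      ∑-wreath zero    h h-inj = cong (λ x → x + _) (Ω-empty _)
      ∑-wreath (suc m) h h-inj with h zero in h0≡
      ... | zero = begin
        ∑ (λ gs → Ω (suc m) (wrAct h gs)) (tuples (elems G) (suc m))
          ≡⟨ ∑-tuples-suc (elems G) m _ ⟩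
        ∑ (λ g₀ → ∑ (λ gs → Ω (suc m) (wrAct h (cons g₀ gs))) (tuples (elems G) m)) (elems G)
          ≡⟨ ∑-cong-All (All.map (λ {g₀} (g₀∈G , g₀-adm) → trans
               (∑-cong-All (All.map (λ {gs} gs-adm → Ω-fixed m h (cons g₀ gs) h-inj (λ { zero → g₀-adm ; (suc i) → gs-adm i }) h0≡)
                                    (All-tuples admissible m)))
               (trans (sym (*-distribˡ-∑ (ω g₀) _ (tuples (elems G) m)))
                      (cong (ω g₀ *_) (∑-spliceLabels m h g₀∈G g₀-adm)))) admissible-∈) ⟩
        ∑ (λ g₀ → ω g₀ * ∑-spliced) (elems G)
          ≡⟨ *-distribʳ-∑ ∑-spliced ω (elems G) ⟨
        ∑ ω (elems G) * ∑-spliced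
          ≡⟨ cong₂ _*_ (sym |G|*q≡∑ω) (∑-wreath m (splice h) (splice-injective h h-inj)) ⟩
        |G| * q * (|G| ^ m * q ^ cycles (splice h))
          ≡⟨ interchange |G| q (|G| ^ m) (q ^ cycles (splice h)) ⟩
        |G| ^ suc m * q ^ suc (cycles (splice h))
          ≡⟨ cong (λ c → |G| ^ suc m * q ^ c) (cycles-splice-fixed h h-inj h0≡) ⟨
        |G| ^ suc m * q ^ cycles h ∎
        where
        open ≡-Reasoning
        open +-*-Solver
        ∑-spliced = ∑ (λ gs → Ω m (wrAct (splice h) gs)) (tuples (elems G) m)
        interchange : ∀ a b c d → a * b * (c * d) ≡ a * c * (b * d)
        interchange = solve 4 (λ a b c d → a :* b :* (c :* d) := a :* c :* (b :* d)) refl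
      ... | suc a = begin
        ∑ (λ gs → Ω (suc m) (wrAct h gs)) (tuples (elems G) (suc m))
          ≡⟨ ∑-tuples-suc (elems G) m _ ⟩
        ∑ (λ g₀ → ∑ (λ gs → Ω (suc m) (wrAct h (cons g₀ gs))) (tuples (elems G) m)) (elems G)
          ≡⟨ ∑-cong-All (All.map (λ {g₀} (g₀∈G , g₀-adm) → trans
               (∑-cong-All (All.map (λ {gs} gs-adm → Ω-moved m h (cons g₀ gs) h-inj (λ { zero → g₀-adm ; (suc i) → gs-adm i }) h0≡)
                                    (All-tuples admissible m)))
               (∑-spliceLabels m h g₀∈G g₀-adm)) admissible-∈) ⟩
        ∑ (λ g₀ → ∑-spliced) (elems G)
          ≡⟨ ∑-const ∑-spliced (elems G) ⟩
        |G| * ∑-spliced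
          ≡⟨ cong (|G| *_) (∑-wreath m (splice h) (splice-injective h h-inj)) ⟩
        |G| * (|G| ^ m * q ^ cycles (splice h))
          ≡⟨ *-assoc |G| (|G| ^ m) _ ⟨
        |G| ^ suc m * q ^ cycles (splice h)
          ≡⟨ cong (λ c → |G| ^ suc m * q ^ c) (cycles-splice-moved h h-inj h0≡) ⟨
        |G| ^ suc m * q ^ cycles h ∎
        where
        open ≡-Reasoning
        ∑-spliced = ∑ (λ gs → Ω m (wrAct (splice h) gs)) (tuples (elems G) m)

      ∑-wreathProduct : ∀ {m} (H : PermGroup m) → All (Injective _≡_ _≡_) (elems H) →
                        ∑ (Ω m) (wreath G H) ≡ |G| ^ m * F (elems H) q
      ∑-wreathProduct {m} H H-inj = begin
        ∑ (Ω m) (wreath G H)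
          ≡⟨ ∑-concatMap (Ω m) (λ h → map (wrAct h) (tuples (elems G) m)) (elems H) ⟩
        ∑ (λ h → ∑ (Ω m) (map (wrAct h) (tuples (elems G) m))) (elems H)
          ≡⟨ ∑-cong (λ h → ∑-map (Ω m) (wrAct h) (tuples (elems G) m)) (elems H) ⟩
        ∑ (λ h → ∑ (λ gs → Ω m (wrAct h gs)) (tuples (elems G) m)) (elems H)
          ≡⟨ ∑-cong-All (All.map (∑-wreath m _) H-inj) ⟩
        ∑ (λ h → |G| ^ m * q ^ cycles h) (elems H)
          ≡⟨ *-distribˡ-∑ (|G| ^ m) _ (elems H) ⟨
        |G| ^ m * ∑ (λ h → q ^ cycles h) (elems H)
          ≡⟨ cong (|G| ^ m *_) (∑-as-foldr _ (elems H)) ⟩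
        |G| ^ m * F (elems H) q ∎
        where open ≡-Reasoning

open import Data.Fin using (zero)
open import Data.List.Relation.Unary.All as All using (All)
open import Data.Nat as ℕ using (ℕ)
import Data.Nat.Properties as ℕ
open import Data.Nat.Divisibility using (divides)
open import Data.Product using (_×_; _,_; proj₁; proj₂)
open import Data.Rational using (ℚ; 1ℚ; _*_; -_)
open import Data.Rational.Properties using (*-assoc; *-comm; *-identityˡ; *-identityʳ)
open import Function.Definitions using (Injective)
open import Relation.Binary.PropositionalEquality hiding (_≗_)

open import Defs
open Rationals
open Quotients using (chromQuot-cong; cycles-cong)
open WreathCount
open CycleCount
open Sign
open WreathSum

injective-elems : ∀ {k} (K : PermGroup k) → All (Injective _≡_ _≡_) (elems K)
injective-elems K = All.map proj₁ (bij K)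

onto-elems : ∀ {k} (K : PermGroup k) → All Onto (elems K)
onto-elems K = All.map (λ b k → proj₁ (proj₂ b k) , proj₂ (proj₂ b k) refl) (bij K)

module _ {n : ℕ} (G : PermGroup n) where

  module Chromatic (adj : Adj n) (G≤Aut : All (Automorphism adj) (elems G)) (x : ℕ) =
    Multiplicative G
      (λ g → Injective _≡_ _≡_ g × Automorphism adj g)
      (All.zipWith (λ (b , a) → proj₁ b , a) (bij G , G≤Aut)) proj₁
      (λ g → fromℕ (chromQuot adj g x))
      (λ m σ → fromℕ (chromQuot (copiesAdj m adj) σ x))
      (λ σ → refl)
      (λ m σ≗τ → cong fromℕ (chromQuot-cong _ σ≗τ x))
      (λ m h gs h-inj adm h0≡0 → trans (cong fromℕ (chromQuot-wreath-splice-fixed adj h h-inj gs h0≡0))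
                                       (fromℕ-* (chromQuot adj (gs zero) x) _))
      (λ m h gs h-inj adm h0≡ → cong fromℕ (chromQuot-wreath-splice-moved adj h h-inj gs h0≡ (proj₂ (adm zero))))
      (P adj (elems G) x ÷order G)
      (trans (fromℕ-*-/ (order G) {{order-nonZero G}} (P adj (elems G) x))
             (fromℕ-sumℕ (λ g → chromQuot adj g x) (elems G)))

  module CycleIndex (z q : ℚ) (|G|*q≡ : fromℕ (order G) * q ≡ F (elems G) z) =
    Multiplicative G (Injective _≡_ _≡_) (injective-elems G) (λ inj → inj)
      (λ g → z ^ cycles g)
      (λ m σ → z ^ cycles σ)
      (λ σ → refl)
      (λ m σ≗τ → cong (z ^_) (cycles-cong σ≗τ))
      (λ m h gs h-inj gs-inj h0≡0 → trans (cong (z ^_) (cycles-wreath-splice-fixed h h-inj gs gs-inj h0≡0))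
                                          (^-distribˡ-+-* z (cycles (gs zero)) _))
      (λ m h gs h-inj gs-inj h0≡ → cong (z ^_) (cycles-wreath-splice-moved h h-inj gs gs-inj h0≡))
      q (trans |G|*q≡ (sym (∑-as-foldr _ (elems G))))

^-+-double : ∀ {s} → s * s ≡ 1ℚ → ∀ a k → s ^ (a ℕ.+ (k ℕ.+ k)) ≡ s ^ a
^-+-double {s} s²≡1 a k = begin
  s ^ (a ℕ.+ (k ℕ.+ k))       ≡⟨ ^-distribˡ-+-* s a (k ℕ.+ k) ⟩
  s ^ a * s ^ (k ℕ.+ k)       ≡⟨ cong (s ^ a *_) (^-distribˡ-+-* s k k) ⟩
  s ^ a * (s ^ k * s ^ k)     ≡⟨ cong (s ^ a *_) (^-distribʳ-* s s k) ⟨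
  s ^ a * (s * s) ^ k         ≡⟨ cong (λ t → s ^ a * t ^ k) s²≡1 ⟩
  s ^ a * 1ℚ ^ k              ≡⟨ cong (s ^ a *_) (^-zeroˡ k) ⟩
  s ^ a * 1ℚ                  ≡⟨ *-identityʳ (s ^ a) ⟩
  s ^ a                       ∎
  where open ≡-Reasoning

sign-even-cycles : ∀ {m} (h : Map m) → Injective _≡_ _≡_ h → Onto h → EvenPerm h →
                   ∀ {s} → s * s ≡ 1ℚ → s ^ cycles h ≡ s ^ m
sign-even-cycles {m} h h-inj h-onto (divides j inv≡) {s} s²≡1 with cycles+inversions m h h-inj h-onto
... | k , c+i≡ = begin
  s ^ cycles h                         ≡⟨ ^-+-double s²≡1 (cycles h) j ⟨
  s ^ (cycles h ℕ.+ (j ℕ.+ j))         ≡⟨ cong (λ i → s ^ (cycles h ℕ.+ i)) inv≡j+j ⟨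
  s ^ (cycles h ℕ.+ inversions h)      ≡⟨ cong (s ^_) c+i≡ ⟩
  s ^ (m ℕ.+ (k ℕ.+ k))                ≡⟨ ^-+-double s²≡1 m k ⟩
  s ^ m                                ∎
  where
  open ≡-Reasoning
  inv≡j+j : inversions h ≡ j ℕ.+ j
  inv≡j+j = trans inv≡ (trans (ℕ.*-comm j 2) (cong (j ℕ.+_) (ℕ.+-identityʳ j)))

F-sign : ∀ {m} (H : PermGroup m) → All EvenPerm (elems H) → ∀ {s} → s * s ≡ 1ℚ → ∀ q →
         F (elems H) (s * q) ≡ s ^ m * F (elems H) q
F-sign {m} H even {s} s²≡1 q = begin
  F (elems H) (s * q)                        ≡⟨ ∑-as-foldr _ (elems H) ⟨
  ∑ (λ h → (s * q) ^ cycles h) (elems H)     ≡⟨ ∑-cong-All (All.zipWith (λ (inj , onto , ev) → sign inj onto ev)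
                                                  (injective-elems H , All.zip (onto-elems H , even))) ⟩
  ∑ (λ h → s ^ m * q ^ cycles h) (elems H)   ≡⟨ *-distribˡ-∑ (s ^ m) _ (elems H) ⟨
  s ^ m * ∑ (λ h → q ^ cycles h) (elems H)   ≡⟨ cong (s ^ m *_) (∑-as-foldr _ (elems H)) ⟩
  s ^ m * F (elems H) q                      ∎
  where
  open ≡-Reasoning
  sign : ∀ {h} → Injective _≡_ _≡_ h → Onto h → EvenPerm h → (s * q) ^ cycles h ≡ s ^ m * q ^ cycles h
  sign {h} inj onto ev = trans (^-distribʳ-* s q (cycles h)) (cong (_* q ^ cycles h) (sign-even-cycles h inj onto ev s²≡1))

module _ {n m : ℕ} (Δ : SimpleGraph n) (G : PermGroup n) (H : PermGroup m) (G≤Aut : G ≤Aut Δ) where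

  private
    adj = SimpleGraph.adj Δ
    Γ   = copiesAdj m adj
    |G| = fromℕ (order G)
    s   = (- 1ℚ) ^ n
    module Chr (x : ℕ) = Chromatic G adj G≤Aut x

    s²≡1 : s * s ≡ 1ℚ
    s²≡1 = trans (sym (^-distribʳ-* (- 1ℚ) (- 1ℚ) n)) (^-zeroˡ n)

  chromatic-wreath : ∀ x → fromℕ (P Γ (wreath G H) x) ≡ |G| ^ m * F (elems H) (P adj (elems G) x ÷order G)
  chromatic-wreath x = trans (fromℕ-sumℕ _ (wreath G H)) (Chr.∑-wreathProduct x H (injective-elems H))

  reciprocal-wreath : Reciprocal adj (elems G) → All EvenPerm (elems H) → Reciprocal Γ (wreath G H)
  reciprocal-wreath reciprocal even x = begin
    fromℕ (P Γ (wreath G H) x)                 ≡⟨ chromatic-wreath x ⟩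
    |G| ^ m * F (elems H) q                    ≡⟨ *-identityˡ _ ⟨
    1ℚ * (|G| ^ m * F (elems H) q)             ≡⟨ cong (_* (|G| ^ m * F (elems H) q)) sᵐ²≡1 ⟨
    s ^ m * s ^ m * (|G| ^ m * F (elems H) q)  ≡⟨ regroup (s ^ m) (|G| ^ m) (F (elems H) q) ⟩
    s ^ m * (|G| ^ m * (s ^ m * F (elems H) q)) ≡⟨ cong (λ t → s ^ m * (|G| ^ m * t)) (F-sign H even s²≡1 q) ⟨
    s ^ m * (|G| ^ m * F (elems H) (s * q))    ≡⟨ cong (s ^ m *_) (Cyc.∑-wreathProduct H (injective-elems H)) ⟨
    s ^ m * ∑ (λ σ → z ^ cycles σ) (wreath G H) ≡⟨ cong₂ _*_ (^-*-assoc (- 1ℚ) n m) (∑-as-foldr _ (wreath G H)) ⟩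
    (- 1ℚ) ^ (n ℕ.* m) * F (wreath G H) z      ≡⟨ cong (λ k → (- 1ℚ) ^ k * F (wreath G H) z) (ℕ.*-comm n m) ⟩
    (- 1ℚ) ^ (m ℕ.* n) * F (wreath G H) z      ∎
    where
    open ≡-Reasoning
    open import Data.Rational.Solver using (module +-*-Solver)
    open +-*-Solver
    z = - fromℕ x
    q = P adj (elems G) x ÷order G
    sᵐ²≡1 : s ^ m * s ^ m ≡ 1ℚ
    sᵐ²≡1 = trans (sym (^-distribʳ-* s s m)) (trans (cong (_^ m) s²≡1) (^-zeroˡ m))
    regroup : ∀ a b c → a * a * (b * c) ≡ a * (b * (a * c))
    regroup = solve 3 (λ a b c → a :* a :* (b :* c) := a :* (b :* (a :* c))) refl
    |G|*sq≡ : |G| * (s * q) ≡ F (elems G) z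
    |G|*sq≡ = begin
      |G| * (s * q)                   ≡⟨ *-assoc |G| s q ⟨
      |G| * s * q                     ≡⟨ cong (_* q) (*-comm |G| s) ⟩
      s * |G| * q                     ≡⟨ *-assoc s |G| q ⟩
      s * (|G| * q)                   ≡⟨ cong (s *_) (fromℕ-*-/ (order G) {{order-nonZero G}} (P adj (elems G) x)) ⟩
      s * fromℕ (P adj (elems G) x)   ≡⟨ cong (s *_) (reciprocal x) ⟩
      s * (s * F (elems G) z)         ≡⟨ *-assoc s s _ ⟨
      s * s * F (elems G) z           ≡⟨ cong (_* F (elems G) z) s²≡1 ⟩
      1ℚ * F (elems G) z              ≡⟨ *-identityˡ _ ⟩
      F (elems G) z                   ∎
    module Cyc = CycleIndex G z (s * q) |G|*sq≡

mainTheorem14 : ∀ {n m : ℕ} (Δ : SimpleGraph n) (G : PermGroup n) (H : PermGroup m) →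
    G ≤Aut Δ →
    (∀ (x : ℕ) → fromℕ (P (copiesAdj m (SimpleGraph.adj Δ)) (wreath G H) x)
    ≡ (fromℕ (order G) ^ m) * F (elems H) (P (SimpleGraph.adj Δ) (elems G) x ÷order G))
    × (Reciprocal (SimpleGraph.adj Δ) (elems G) → All EvenPerm (elems H) →
    Reciprocal (copiesAdj m (SimpleGraph.adj Δ)) (wreath G H))
mainTheorem14 Δ G H G≤Aut = chromatic-wreath Δ G H G≤Aut , reciprocal-wreath Δ G H G≤Aut
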